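{- For every integer $c\geq 0$ and every integer $s$ with $0\leq s\leq 3c$ and $s\neq 1$, there exist infinitely many connected signed graphs $(G,\sigma)$ with $c(G)=c$ such that $$\eta(G,\sigma)=|V(G)|-2m(G)+2c(G)-s.$$
   Context: All graphs are finite and simple. A signed graph $(G,\sigma)$ is a graph $G$ with a map $\sigma:E(G)\to\{+,-\}$; its adjacency matrix $A(G,\sigma)$ has $(i,j)$-entry $\sigma(v_iv_j)$ if $v_iv_j\in E(G)$ and $0$ otherwise. The nullity $\eta(G,\sigma)$ is the multiplicity of $0$ as an eigenvalue of $A(G,\sigma)$. $m(G)$ is the matching number of $G$, and $c(G)=|E(G)|-|V(G)|+\theta(G)$, where $\theta(G)$ is the number of connected components of $G$. -}

module Defs where

open import Data.Nat using (ℕ; zero; suc; _<_; _≤_)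
open import Data.Fin using (Fin; toℕ)
open import Data.Product using (_×_; _,_; Σ; ∃-syntax)
open import Data.List using (List; []; _∷_; length; concatMap)
open import Data.List.Relation.Unary.All using (All)
open import Data.List.Relation.Unary.Unique.Propositional using (Unique)
open import Data.Rational using (ℚ; 0ℚ; 1ℚ; -_; _+_; _*_)
open import Data.Integer using (ℤ)
open import Relation.Binary.PropositionalEquality using (_≡_; _≢_)
open import Relation.Nullary using (¬_)
open import Data.List.Membership.Propositional using (_∈_)

data Entry : Set where
  none pos neg : Entry

-- A finite simple signed graph on vertex set Fin order.
-- 'ent i j' encodes both the underlying graph G (edge iff ent i j ≢ none)
-- and the signature σ (pos = +, neg = -).
record SignedGraph : Set where
  field
    order : ℕ
    ent   : Fin order → Fin order → Entry
    sym   : ∀ i j → ent i j ≡ ent j i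
    loopless : ∀ i → ent i i ≡ none
open SignedGraph public

Adj : (Γ : SignedGraph) → Fin (order Γ) → Fin (order Γ) → Set
Adj Γ i j = ent Γ i j ≢ none

entryℚ : Entry → ℚ
entryℚ none = 0ℚ
entryℚ pos  = 1ℚ
entryℚ neg  = - 1ℚ

A : (Γ : SignedGraph) → Fin (order Γ) → Fin (order Γ) → ℚ
A Γ i j = entryℚ (ent Γ i j)

sumFin : ∀ {n} → (Fin n → ℚ) → ℚ
sumFin {zero}  f = 0ℚ
sumFin {suc n} f = f Fin.zero + sumFin (λ i → f (Fin.suc i))

HasEdgeCount : (Γ : SignedGraph) → ℕ → Set
HasEdgeCount Γ e =
  Σ (List (Fin (order Γ) × Fin (order Γ))) λ es →
    Unique es ×
    All (λ p → let (i , j) = p in toℕ i < toℕ j × Adj Γ i j) es ×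
    (∀ i j → toℕ i < toℕ j → Adj Γ i j → (i , j) ∈ es) ×
    length es ≡ e

data Reach (Γ : SignedGraph) : Fin (order Γ) → Fin (order Γ) → Set where
  here : ∀ {i} → Reach Γ i i
  step : ∀ {i j k} → Adj Γ i j → Reach Γ j k → Reach Γ i k

Connected : SignedGraph → Set
Connected Γ = (1 ≤ order Γ) × (∀ i j → Reach Γ i j)

IsMatching : (Γ : SignedGraph) → List (Fin (order Γ) × Fin (order Γ)) → Set
IsMatching Γ M =
  All (λ p → let (i , j) = p in Adj Γ i j) M ×
  Unique (concatMap (λ p → let (i , j) = p in i ∷ j ∷ []) M)

HasMatchingNumber : SignedGraph → ℕ → Set
HasMatchingNumber Γ k =
  (Σ _ λ M → IsMatching Γ M × length M ≡ k) ×
  (∀ M → IsMatching Γ M → length M ≤ k)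

InKernel : (Γ : SignedGraph) → (Fin (order Γ) → ℚ) → Set
InKernel Γ v = ∀ i → sumFin (λ j → A Γ i j * v j) ≡ 0ℚ

LinIndep : ∀ {k n} → (Fin k → Fin n → ℚ) → Set
LinIndep {k} {n} vs =
  ∀ (a : Fin k → ℚ) → (∀ j → sumFin (λ i → a i * vs i j) ≡ 0ℚ) → ∀ i → a i ≡ 0ℚ

-- η(G,σ) = η : the eigenvalue 0 of the symmetric matrix A(G,σ) has
-- multiplicity η, i.e. its kernel has dimension η
HasNullity : SignedGraph → ℕ → Set
HasNullity Γ η =
  (Σ (Fin η → Fin (order Γ) → ℚ) λ vs → LinIndep vs × (∀ i → InKernel Γ (vs i))) ×
  (∀ (vs : Fin (suc η) → Fin (order Γ) → ℚ) → (∀ i → InKernel Γ (vs i)) → ¬ LinIndep vs)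

-- All graphs built here are unsigned: every edge is positive.  Start from a single edge hℓ and
-- repeatedly join the hub h to the attachment vertices of a fresh gadget H.  Because the leaf ℓ
-- is adjacent to h only, the row of ℓ forces every kernel vector to vanish at h; hence kernel
-- vectors of the old graph extend by zero, kernel vectors w of H extend by putting minus the sum
-- of w over the attachments on ℓ, and together they span the new kernel: nullities add.  Every
-- edge at h can be put into the class of hℓ in a cover of the edges by pairwise intersecting
-- classes, so matching numbers add as well, while the cyclomatic number grows by
-- |E(H)| + #attachments − |V(H)|.  Writing s = n − 2m + 2c − η, the pair (c, s) grows by
-- (0, 0) for K₁, (1, 2) for K₂ attached at both ends, (1, 3) for a pendant K₃ and (1, 0) for a
-- pendant C₄, and the starting edge has (0, 0).  So a copies of K₂, b of K₃ and z of C₄ realise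
-- c = a + b + z and s = 2a + 3b, which reaches every 0 ≤ s ≤ 3c with s ≠ 1, and N copies of K₁
-- make the graph as large as desired.
--
-- Nullities are certified by pivot bases: kernel vectors bₖ and vertices pₗ with bₖ(pₗ) = δₖₗ
-- such that a kernel vector vanishing at all pₗ is zero; any η + 1 kernel vectors are then
-- dependent because η + 1 vectors in ℚ^η are.  Matching numbers are certified by a matching of
-- size m together with a cover of the edges by m classes of pairwise intersecting edges.

module Submission where

open import Defs

module LinearAlgebra where

  open import Algebra.Bundles using (CommutativeRing)
  open import Data.Fin using (Fin; zero; suc; _↑ˡ_; _↑ʳ_; punchIn; punchOut)
  open import Data.Fin.Properties using (any?; punchInᵢ≢i; punchIn-punchOut) renaming (_≟_ to _≟ᶠ_)
  open import Data.Nat using (ℕ) renaming (_+_ to _+ℕ_)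
  open import Data.Product using (Σ-syntax; ∃-syntax; _×_; _,_)
  open import Data.Rational using (ℚ; 0ℚ; 1ℚ; -_; _+_; _*_; _-_; 1/_; ≢-nonZero)
  open import Data.Rational.Properties
    using (_≟_; +-*-commutativeRing; +-identityˡ; +-identityʳ; +-assoc; *-zeroˡ; *-zeroʳ; *-identityʳ; *-inverseˡ; *-assoc)
  open import Function using (_∘_)
  open import Level using (0ℓ)
  open import Relation.Nullary using (¬_; yes; no; ¬?)
  open import Relation.Nullary.Decidable using (dec⇒maybe; decidable-stable)
  open import Relation.Binary.PropositionalEquality as ≡
    using (_≡_; _≢_; refl; cong; cong₂; subst; module ≡-Reasoning)
  open import Tactic.RingSolver using (solve-∀)
  import Tactic.RingSolver.Core.AlmostCommutativeRing as ACR
  open import Algebra.Properties.Semiring.Sum (CommutativeRing.semiring +-*-commutativeRing)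
    using (sum; sum-cong-≗; sum-replicate-zero; ∑-distrib-+; *-distribˡ-sum; sum-remove)

  ℚ-ring : ACR.AlmostCommutativeRing 0ℓ 0ℓ
  ℚ-ring = ACR.fromCommutativeRing +-*-commutativeRing (λ x → dec⇒maybe (0ℚ ≟ x))

  sumFin≡sum : ∀ {n} (f : Fin n → ℚ) → sumFin f ≡ sum f
  sumFin≡sum {ℕ.zero} f = refl
  sumFin≡sum {ℕ.suc n} f = cong (f zero +_) (sumFin≡sum (f ∘ suc))

  module _ {n : ℕ} where

    sumFin-cong : {f g : Fin n → ℚ} → (∀ i → f i ≡ g i) → sumFin f ≡ sumFin g
    sumFin-cong {f} {g} f≗g rewrite sumFin≡sum f | sumFin≡sum g = sum-cong-≗ f≗g

    sumFin-zero : {f : Fin n → ℚ} → (∀ i → f i ≡ 0ℚ) → sumFin f ≡ 0ℚ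
    sumFin-zero {f} f≗0 rewrite sumFin≡sum f = ≡.trans (sum-cong-≗ f≗0) (sum-replicate-zero n)

    sumFin-+ : (f g : Fin n → ℚ) → sumFin (λ i → f i + g i) ≡ sumFin f + sumFin g
    sumFin-+ f g rewrite sumFin≡sum (λ i → f i + g i) | sumFin≡sum f | sumFin≡sum g = ∑-distrib-+ f g

    *-distribˡ-sumFin : (x : ℚ) (f : Fin n → ℚ) → x * sumFin f ≡ sumFin (λ i → x * f i)
    *-distribˡ-sumFin x f rewrite sumFin≡sum f | sumFin≡sum (λ i → x * f i) = *-distribˡ-sum x f

    sumFin-comm : ∀ {m} (f : Fin m → Fin n → ℚ) →
                  sumFin (λ i → sumFin (f i)) ≡ sumFin (λ j → sumFin (λ i → f i j))
    sumFin-comm {ℕ.zero} f = ≡.sym (sumFin-zero (λ _ → refl))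
    sumFin-comm {ℕ.suc m} f =
      ≡.trans (cong (sumFin (f zero) +_) (sumFin-comm (f ∘ suc))) (≡.sym (sumFin-+ (f zero) _))

  sumFin-↑ : ∀ m {n} (f : Fin (m +ℕ n) → ℚ) → sumFin f ≡ sumFin (f ∘ (_↑ˡ n)) + sumFin (f ∘ (m ↑ʳ_))
  sumFin-↑ ℕ.zero f = ≡.sym (+-identityˡ (sumFin f))
  sumFin-↑ (ℕ.suc m) f =
    ≡.trans (cong (f zero +_) (sumFin-↑ m (f ∘ suc))) (≡.sym (+-assoc (f zero) _ _))

  sumFin-single : ∀ {n} {f : Fin n → ℚ} (i : Fin n) → (∀ j → j ≢ i → f j ≡ 0ℚ) → sumFin f ≡ f i
  sumFin-single {ℕ.suc _} {f} i f≗0 = begin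
    sumFin f                                   ≡⟨ sumFin≡sum f ⟩
    sum f                                      ≡⟨ sum-remove {i = i} f ⟩
    f i + sum (λ j → f (punchIn i j))          ≡⟨ cong (f i +_) (sumFin≡sum (λ j → f (punchIn i j))) ⟨
    f i + sumFin (λ j → f (punchIn i j))       ≡⟨ cong (f i +_) (sumFin-zero (λ j → f≗0 _ (punchInᵢ≢i i j))) ⟩
    f i + 0ℚ                                   ≡⟨ +-identityʳ (f i) ⟩
    f i                                        ∎
    where open ≡-Reasoning

  infixr 7 _*ᵥ_
  _*ᵥ_ : ∀ {n} → (Fin n → Fin n → ℚ) → (Fin n → ℚ) → Fin n → ℚ
  (M *ᵥ v) i = sumFin (λ j → M i j * v j)

  *ᵥ-cong : ∀ {n} (M : Fin n → Fin n → ℚ) {v w : Fin n → ℚ} → (∀ j → v j ≡ w j) →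
            ∀ i → (M *ᵥ v) i ≡ (M *ᵥ w) i
  *ᵥ-cong M v≗w i = sumFin-cong (λ j → cong (M i j *_) (v≗w j))

  *-vanishʳ : ∀ x {y} → y ≡ 0ℚ → x * y ≡ 0ℚ
  *-vanishʳ x refl = *-zeroʳ x

  sumFin-zeroʳ : ∀ {n} (f : Fin n → ℚ) {v : Fin n → ℚ} → (∀ j → v j ≡ 0ℚ) →
                 sumFin (λ j → f j * v j) ≡ 0ℚ
  sumFin-zeroʳ f v≗0 = sumFin-zero (λ j → *-vanishʳ (f j) (v≗0 j))

  +-eliminateʳ : ∀ x {y} → y ≡ 0ℚ → x + y ≡ x
  +-eliminateʳ x refl = +-identityʳ x

  +-eliminateˡ : ∀ {x} y → x ≡ 0ℚ → x + y ≡ y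
  +-eliminateˡ y refl = +-identityˡ y

  linComb : ∀ {k n} → (Fin k → ℚ) → (Fin k → Fin n → ℚ) → Fin n → ℚ
  linComb a w j = sumFin (λ i → a i * w i j)

  Dependent : ∀ {k n} → (Fin k → Fin n → ℚ) → Set
  Dependent {k} {n} w =
    Σ[ a ∈ (Fin k → ℚ) ] (∃[ i ] a i ≢ 0ℚ) × (∀ j → linComb a w j ≡ 0ℚ)

  Dependent⇒¬LinIndep : ∀ {k n} {w : Fin k → Fin n → ℚ} → Dependent w → ¬ LinIndep w
  Dependent⇒¬LinIndep (a , (i , aᵢ≢0) , a·w≡0) independent = aᵢ≢0 (independent a a·w≡0 i)

  head-zero⇒Dependent : ∀ {k n} (w : Fin (ℕ.suc k) → Fin n → ℚ) → (∀ j → w zero j ≡ 0ℚ) → Dependent w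
  head-zero⇒Dependent w w₀≡0 = e₀ , (zero , λ ()) , λ j →
    ≡.trans (cong₂ (λ x y → 1ℚ * x + y) (w₀≡0 j) (sumFin-zero (λ i → *-zeroˡ (w (suc i) j)))) refl
    where
    e₀ : Fin (ℕ.suc _) → ℚ
    e₀ zero = 1ℚ
    e₀ (suc _) = 0ℚ

  -- Gaussian elimination with pivot w zero j: subtracting multiples of w zero clears column j
  -- from the other vectors, and a dependency among the cleared vectors (column j dropped)
  -- lifts to one among w.
  module Elimination {k n} (w : Fin (ℕ.suc k) → Fin (ℕ.suc n) → ℚ) (j : Fin (ℕ.suc n))
                     (w₀ⱼ≢0 : w zero j ≢ 0ℚ) where

    private instance
      _ = ≢-nonZero w₀ⱼ≢0

    ratio : Fin k → ℚ
    ratio i = w (suc i) j * 1/ w zero j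

    residual : Fin k → Fin (ℕ.suc n) → ℚ
    residual i m = w (suc i) m - ratio i * w zero m

    residual-pivot : ∀ i → residual i j ≡ 0ℚ
    residual-pivot i = begin
      w (suc i) j - w (suc i) j * 1/ p * p     ≡⟨ cong (λ x → w (suc i) j - x) (*-assoc (w (suc i) j) (1/ p) p) ⟩
      w (suc i) j - w (suc i) j * (1/ p * p)   ≡⟨ cong (λ x → w (suc i) j - w (suc i) j * x) (*-inverseˡ p) ⟩
      w (suc i) j - w (suc i) j * 1ℚ           ≡⟨ x-x*1≡0 (w (suc i) j) ⟩
      0ℚ                                       ∎
      where
      open ≡-Reasoning
      p = w zero j
      x-x*1≡0 : ∀ x → x - x * 1ℚ ≡ 0ℚ
      x-x*1≡0 = solve-∀ ℚ-ring

    extend : (Fin k → ℚ) → Fin (ℕ.suc k) → ℚ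
    extend b zero = - sumFin (λ i → b i * ratio i)
    extend b (suc i) = b i

    extend-combination : ∀ b m → linComb (extend b) w m ≡ linComb b residual m
    extend-combination b m = begin
      (- S) * y + T
        ≡⟨ move S y T ⟩
      T + (- y) * S
        ≡⟨ cong (T +_) (*-distribˡ-sumFin (- y) (λ i → b i * ratio i)) ⟩
      T + sumFin (λ i → (- y) * (b i * ratio i))
        ≡⟨ sumFin-+ (λ i → b i * w (suc i) m) (λ i → (- y) * (b i * ratio i)) ⟨
      sumFin (λ i → b i * w (suc i) m + (- y) * (b i * ratio i))
        ≡⟨ sumFin-cong (λ i → expand (b i) (w (suc i) m) (ratio i) y) ⟨
      sumFin (λ i → b i * residual i m)
        ∎
      where
      open ≡-Reasoning
      y = w zero m
      S = sumFin (λ i → b i * ratio i)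
      T = sumFin (λ i → b i * w (suc i) m)
      move : ∀ S y T → (- S) * y + T ≡ T + (- y) * S
      move = solve-∀ ℚ-ring
      expand : ∀ b x r y → b * (x - r * y) ≡ b * x + (- y) * (b * r)
      expand = solve-∀ ℚ-ring

    reduced : Fin k → Fin n → ℚ
    reduced i l = residual i (punchIn j l)

    dependent : Dependent reduced → Dependent w
    dependent (b , (i , bᵢ≢0) , b·r≡0) =
      extend b , (suc i , bᵢ≢0) , λ m → ≡.trans (extend-combination b m) (b·residual≡0 m)
      where
      b·residual≡0 : ∀ m → linComb b residual m ≡ 0ℚ
      b·residual≡0 m with m ≟ᶠ j
      ... | yes refl = sumFin-zero (λ i → *-vanishʳ (b i) (residual-pivot i))
      ... | no m≢j = subst (λ m → linComb b residual m ≡ 0ℚ)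
                           (punchIn-punchOut (m≢j ∘ ≡.sym)) (b·r≡0 (punchOut (m≢j ∘ ≡.sym)))

  suc-vectors-dependent : ∀ n (w : Fin (ℕ.suc n) → Fin n → ℚ) → Dependent w
  suc-vectors-dependent ℕ.zero w = (λ _ → 1ℚ) , (zero , λ ()) , λ ()
  suc-vectors-dependent (ℕ.suc n) w with any? (λ j → ¬? (w zero j ≟ 0ℚ))
  ... | yes (j , w₀ⱼ≢0) = dependent (suc-vectors-dependent n reduced)
    where open Elimination w j w₀ⱼ≢0
  ... | no ∄j = head-zero⇒Dependent w (λ j → decidable-stable (w zero j ≟ 0ℚ) (∄j ∘ (j ,_)))

  InKernel-combination : ∀ (Γ : SignedGraph) {k} (vs : Fin k → Fin (order Γ) → ℚ) (a : Fin k → ℚ) →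
                         (∀ i → InKernel Γ (vs i)) → InKernel Γ (linComb a vs)
  InKernel-combination Γ vs a vsᵢ∈ker r = begin
    sumFin (λ j → A Γ r j * sumFin (λ i → a i * vs i j))
      ≡⟨ sumFin-cong (λ j → *-distribˡ-sumFin (A Γ r j) (λ i → a i * vs i j)) ⟩
    sumFin (λ j → sumFin (λ i → A Γ r j * (a i * vs i j)))
      ≡⟨ sumFin-comm (λ j i → A Γ r j * (a i * vs i j)) ⟩
    sumFin (λ i → sumFin (λ j → A Γ r j * (a i * vs i j)))
      ≡⟨ sumFin-cong (λ i → sumFin-cong (λ j → swap (A Γ r j) (a i) (vs i j))) ⟩
    sumFin (λ i → sumFin (λ j → a i * (A Γ r j * vs i j)))
      ≡⟨ sumFin-cong (λ i → *-distribˡ-sumFin (a i) (λ j → A Γ r j * vs i j)) ⟨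
    sumFin (λ i → a i * sumFin (λ j → A Γ r j * vs i j))
      ≡⟨ sumFin-zero (λ i → *-vanishʳ (a i) (vsᵢ∈ker i r)) ⟩
    0ℚ
      ∎
    where
    open ≡-Reasoning
    swap : ∀ x y z → x * (y * z) ≡ y * (x * z)
    swap = solve-∀ ℚ-ring

  record PivotBasis (Γ : SignedGraph) (η : ℕ) : Set where
    field
      pivot : Fin η → Fin (order Γ)
      basis : Fin η → Fin (order Γ) → ℚ
      basis-pivot : ∀ k → basis k (pivot k) ≡ 1ℚ
      basis-pivot-≢ : ∀ {k l} → k ≢ l → basis k (pivot l) ≡ 0ℚ
      basis-kernel : ∀ k → InKernel Γ (basis k)
      kernel-determined : ∀ v → InKernel Γ v → (∀ l → v (pivot l) ≡ 0ℚ) → ∀ i → v i ≡ 0ℚ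

    combination-pivot : (a : Fin η → ℚ) (l : Fin η) → linComb a basis (pivot l) ≡ a l
    combination-pivot a l = begin
      sumFin (λ k → a k * basis k (pivot l))   ≡⟨ sumFin-single l (λ k k≢l → *-vanishʳ (a k) (basis-pivot-≢ k≢l)) ⟩
      a l * basis l (pivot l)                  ≡⟨ cong (a l *_) (basis-pivot l) ⟩
      a l * 1ℚ                                 ≡⟨ *-identityʳ (a l) ⟩
      a l                                      ∎
      where open ≡-Reasoning

    independent : LinIndep basis
    independent a a·basis≡0 l = ≡.trans (≡.sym (combination-pivot a l)) (a·basis≡0 (pivot l))

    kernel-dimension-≤ : ∀ (vs : Fin (ℕ.suc η) → Fin (order Γ) → ℚ) →
                         (∀ i → InKernel Γ (vs i)) → ¬ LinIndep vs
    kernel-dimension-≤ vs vsᵢ∈ker with suc-vectors-dependent η (λ i l → vs i (pivot l))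
    ... | a , a≢0 , a·vs≡0-on-pivots = Dependent⇒¬LinIndep {w = vs} (a , a≢0 , a·vs≡0)
      where
      a·vs≡0 : ∀ j → linComb a vs j ≡ 0ℚ
      a·vs≡0 = kernel-determined (linComb a vs) (InKernel-combination Γ vs a vsᵢ∈ker) a·vs≡0-on-pivots

    nullity : HasNullity Γ η
    nullity = (basis , independent , basis-kernel) , kernel-dimension-≤

  nonsingular⇒PivotBasis : ∀ {Γ} → (∀ v → InKernel Γ v → ∀ i → v i ≡ 0ℚ) → PivotBasis Γ 0
  nonsingular⇒PivotBasis kernel-zero = record
    { pivot = λ () ; basis = λ () ; basis-pivot = λ () ; basis-pivot-≢ = λ { {()} }
    ; basis-kernel = λ () ; kernel-determined = λ v v∈ker _ → kernel-zero v v∈ker }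

module Graphs where

  open LinearAlgebra
  open import Data.Bool using (Bool; true; false; _∧_; if_then_else_)
  open import Data.Empty using (⊥-elim)
  open import Data.Fin using (Fin; toℕ)
  open import Data.Fin.Properties using (injective⇒≤; toℕ<n) renaming (_≟_ to _≟ᶠ_)
  open import Data.List using (List; []; _∷_; length; lookup; concatMap)
  open import Data.List.Membership.Propositional using (_∈_)
  open import Data.List.Membership.Propositional.Properties using (∈-lookup)
  open import Data.List.Relation.Unary.All as All using (All; []; _∷_)
  open import Data.List.Relation.Unary.Unique.Propositional using (Unique; []; _∷_)
  open import Data.Nat using (ℕ; _≤_; _<_; s≤s; z≤n)
  open import Data.Nat.Properties using (≤-trans)
  open import Data.Product using (_×_; _,_; proj₁; proj₂)
  open import Data.Rational using (ℚ; 0ℚ; _*_)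
  open import Data.Rational.Properties using (*-identityˡ; *-zeroˡ; *-assoc)
  open import Data.Sum using (_⊎_; inj₁; inj₂)
  open import Function using (_∘_)
  open import Relation.Binary.PropositionalEquality as ≡ using (_≡_; _≢_; refl; cong; subst)
  open import Relation.Nullary using (¬_; does)
  open import Relation.Nullary.Decidable using (dec-true; dec-false)

  Unique-lookup-injective : ∀ {A : Set} {xs : List A} → Unique xs →
                            ∀ {i j} → lookup xs i ≡ lookup xs j → i ≡ j
  Unique-lookup-injective (_ ∷ _) {Fin.zero} {Fin.zero} _ = refl
  Unique-lookup-injective (x∉xs ∷ _) {Fin.zero} {Fin.suc j} x≡xsⱼ =
    ⊥-elim (All.lookup x∉xs (∈-lookup j) x≡xsⱼ)
  Unique-lookup-injective (x∉xs ∷ _) {Fin.suc i} {Fin.zero} xsᵢ≡x =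
    ⊥-elim (All.lookup x∉xs (∈-lookup i) (≡.sym xsᵢ≡x))
  Unique-lookup-injective (_ ∷ xs-unique) {Fin.suc i} {Fin.suc j} e =
    cong Fin.suc (Unique-lookup-injective xs-unique e)

  Unique-length≤ : ∀ {K} {xs : List (Fin K)} → Unique xs → length xs ≤ K
  Unique-length≤ xs-unique = injective⇒≤ (Unique-lookup-injective xs-unique)

  record Graph (n : ℕ) : Set where
    field
      adj : Fin n → Fin n → Bool
      adj-sym : ∀ i j → adj i j ≡ adj j i
      adj-irrefl : ∀ i → adj i i ≡ false
  open Graph public

  fromBool : Bool → Entry
  fromBool b = if b then pos else none

  -- Defined through entryℚ so that A (allPositive G) i j reduces to 𝟙 (adj G i j).
  𝟙 : Bool → ℚ
  𝟙 b = entryℚ (fromBool b)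

  allPositive : ∀ {n} → Graph n → SignedGraph
  allPositive {n} G = record
    { order = n
    ; ent = λ i j → fromBool (adj G i j)
    ; sym = λ i j → cong fromBool (adj-sym G i j)
    ; loopless = λ i → cong fromBool (adj-irrefl G i)
    }

  fromBool≢none⇒true : ∀ {b} → fromBool b ≢ none → b ≡ true
  fromBool≢none⇒true {true} _ = refl
  fromBool≢none⇒true {false} none≢none = ⊥-elim (none≢none refl)

  true⇒fromBool≢none : ∀ {b} → b ≡ true → fromBool b ≢ none
  true⇒fromBool≢none refl ()

  𝟙-∧ : ∀ x y → 𝟙 (x ∧ y) ≡ 𝟙 x * 𝟙 y
  𝟙-∧ true true = refl
  𝟙-∧ true false = refl
  𝟙-∧ false y = ≡.sym (*-zeroˡ (𝟙 y))

  𝟙-∧-* : ∀ x y z → 𝟙 (x ∧ y) * z ≡ 𝟙 x * (𝟙 y * z)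
  𝟙-∧-* x y z = ≡.trans (cong (_* z) (𝟙-∧ x y)) (*-assoc (𝟙 x) (𝟙 y) z)

  𝟙-false-* : ∀ {b} x → b ≡ false → 𝟙 b * x ≡ 0ℚ
  𝟙-false-* x refl = *-zeroˡ x

  sumFin-sift : ∀ {n} (i : Fin n) (f : Fin n → ℚ) → sumFin (λ j → 𝟙 (does (j ≟ᶠ i)) * f j) ≡ f i
  sumFin-sift i f =
    ≡.trans (sumFin-single i off-i) (≡.trans (cong (λ b → 𝟙 b * f i) (dec-true (i ≟ᶠ i) refl)) (*-identityˡ (f i)))
    where
    off-i : ∀ j → j ≢ i → 𝟙 (does (j ≟ᶠ i)) * f j ≡ 0ℚ
    off-i j j≢i = ≡.trans (cong (λ b → 𝟙 b * f j) (dec-false (j ≟ᶠ i) j≢i)) (*-zeroˡ (f j))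

  Adj-sym : ∀ {Γ i j} → Adj Γ i j → Adj Γ j i
  Adj-sym {Γ} {i} {j} ij≢none ji≡none = ij≢none (≡.trans (sym Γ i j) ji≡none)

  Reach-trans : ∀ {Γ i j k} → Reach Γ i j → Reach Γ j k → Reach Γ i k
  Reach-trans here jk = jk
  Reach-trans (step e ij) jk = step e (Reach-trans ij jk)

  Reach-sym : ∀ {Γ i j} → Reach Γ i j → Reach Γ j i
  Reach-sym here = here
  Reach-sym {Γ} (step e ij) = Reach-trans (Reach-sym ij) (step (Adj-sym {Γ} e) here)

  Reach-map : ∀ {Γ Δ} (f : Fin (order Γ) → Fin (order Δ)) → (∀ {a b} → Adj Γ a b → Adj Δ (f a) (f b)) →
              ∀ {a b} → Reach Γ a b → Reach Δ (f a) (f b)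
  Reach-map f f-adj here = here
  Reach-map f f-adj (step e r) = step (f-adj e) (Reach-map f f-adj r)

  hub⇒Connected : ∀ {Γ} (h : Fin (order Γ)) → (∀ i → Reach Γ i h) → Connected Γ
  hub⇒Connected h reach = ≤-trans (s≤s z≤n) (toℕ<n h) , λ i j → Reach-trans (reach i) (Reach-sym (reach j))

  Meet : ∀ {V : Set} → V → V → V → V → Set
  Meet i j i′ j′ = i ≡ i′ ⊎ i ≡ j′ ⊎ j ≡ i′ ⊎ j ≡ j′

  Meet-injective : ∀ {V W : Set} {f : V → W} → (∀ {x y} → f x ≡ f y → x ≡ y) →
                   ∀ {i j i′ j′} → Meet (f i) (f j) (f i′) (f j′) → Meet i j i′ j′
  Meet-injective f-inj (inj₁ e) = inj₁ (f-inj e)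
  Meet-injective f-inj (inj₂ (inj₁ e)) = inj₂ (inj₁ (f-inj e))
  Meet-injective f-inj (inj₂ (inj₂ (inj₁ e))) = inj₂ (inj₂ (inj₁ (f-inj e)))
  Meet-injective f-inj (inj₂ (inj₂ (inj₂ e))) = inj₂ (inj₂ (inj₂ (f-inj e)))

  Meet-map : ∀ {V W : Set} (f : V → W) → ∀ {i j i′ j′} → Meet i j i′ j′ → Meet (f i) (f j) (f i′) (f j′)
  Meet-map f (inj₁ e) = inj₁ (cong f e)
  Meet-map f (inj₂ (inj₁ e)) = inj₂ (inj₁ (cong f e))
  Meet-map f (inj₂ (inj₂ (inj₁ e))) = inj₂ (inj₂ (inj₁ (cong f e)))
  Meet-map f (inj₂ (inj₂ (inj₂ e))) = inj₂ (inj₂ (inj₂ (cong f e)))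

  record IntersectingCover {n} (G : Graph n) (K : ℕ) : Set where
    field
      class : ∀ i j → adj G i j ≡ true → Fin K
      class-meet : ∀ {i j i′ j′} (e : adj G i j ≡ true) (e′ : adj G i′ j′ ≡ true) →
                   class i j e ≡ class i′ j′ e′ → Meet i j i′ j′

  endpoints : ∀ {n} → List (Fin n × Fin n) → List (Fin n)
  endpoints = concatMap (λ (i , j) → i ∷ j ∷ [])

  IsMatchingᴳ : ∀ {n} → Graph n → List (Fin n × Fin n) → Set
  IsMatchingᴳ G M = All (λ (i , j) → adj G i j ≡ true) M × Unique (endpoints M)

  module _ {n K} {G : Graph n} (C : IntersectingCover G K) where
    open IntersectingCover C

    private
      classes : (M : List (Fin n × Fin n)) → All (λ (i , j) → adj G i j ≡ true) M → List (Fin K)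
      classes [] [] = []
      classes ((i , j) ∷ M) (e ∷ es) = class i j e ∷ classes M es

      classes-length : ∀ M es → length (classes M es) ≡ length M
      classes-length [] [] = refl
      classes-length (_ ∷ M) (_ ∷ es) = cong ℕ.suc (classes-length M es)

      class∉classes : ∀ {i j} (e : adj G i j ≡ true) M es →
                      All (i ≢_) (endpoints M) → All (j ≢_) (endpoints M) → All (class i j e ≢_) (classes M es)
      class∉classes e [] [] _ _ = []
      class∉classes e ((i′ , j′) ∷ M) (e′ ∷ es) (i≢i′ ∷ i≢j′ ∷ i∉M) (j≢i′ ∷ j≢j′ ∷ j∉M) =
        no-meet ∘ class-meet e e′ ∷ class∉classes e M es i∉M j∉M
        where
        no-meet : ¬ Meet _ _ i′ j′
        no-meet (inj₁ i≡i′) = i≢i′ i≡i′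
        no-meet (inj₂ (inj₁ i≡j′)) = i≢j′ i≡j′
        no-meet (inj₂ (inj₂ (inj₁ j≡i′))) = j≢i′ j≡i′
        no-meet (inj₂ (inj₂ (inj₂ j≡j′))) = j≢j′ j≡j′

      classes-unique : ∀ M es → Unique (endpoints M) → Unique (classes M es)
      classes-unique [] [] _ = []
      classes-unique ((i , j) ∷ M) (e ∷ es) ((_ ∷ i∉M) ∷ j∉M ∷ M-unique) =
        class∉classes e M es i∉M j∉M ∷ classes-unique M es M-unique

    matching-length≤ : ∀ {M} → IsMatchingᴳ G M → length M ≤ K
    matching-length≤ {M} (es , M-unique) =
      subst (_≤ K) (classes-length M es) (Unique-length≤ (classes-unique M es M-unique))

  record EdgeList {n} (G : Graph n) (e : ℕ) : Set where
    field
      edges : List (Fin n × Fin n)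
      edges-unique : Unique edges
      edges-sound : All (λ (i , j) → toℕ i < toℕ j × adj G i j ≡ true) edges
      edges-complete : ∀ i j → toℕ i < toℕ j → adj G i j ≡ true → (i , j) ∈ edges
      edges-length : length edges ≡ e

    hasEdgeCount : HasEdgeCount (allPositive G) e
    hasEdgeCount =
      edges , edges-unique , All.map (λ (i<j , e) → i<j , true⇒fromBool≢none e) edges-sound ,
      (λ i j i<j e → edges-complete i j i<j (fromBool≢none⇒true e)) , edges-length

  record MaximumMatching {n} (G : Graph n) (m : ℕ) : Set where
    field
      matching : List (Fin n × Fin n)
      matching-valid : IsMatchingᴳ G matching
      matching-length : length matching ≡ m
      cover : IntersectingCover G m

    hasMatchingNumber : HasMatchingNumber (allPositive G) m
    hasMatchingNumber =
      (matching , (All.map true⇒fromBool≢none (proj₁ matching-valid) , proj₂ matching-valid) , matching-length) ,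
      λ M (M-adj , M-unique) → matching-length≤ cover (All.map fromBool≢none⇒true M-adj , M-unique)

  record Invariants {n} (G : Graph n) (e m η : ℕ) : Set where
    field
      edgeList : EdgeList G e
      maximumMatching : MaximumMatching G m
      pivotBasis : PivotBasis (allPositive G) η

module Attachment where

  open LinearAlgebra
  open Graphs
  open import Data.Bool using (Bool; true; false; _∧_)
  open import Data.Empty using (⊥-elim)
  open import Data.Fin using (Fin; toℕ; _↑ˡ_; _↑ʳ_; splitAt; join)
  open import Data.Fin.Properties
    using (splitAt-↑ˡ; splitAt-↑ʳ; splitAt⁻¹-↑ˡ; splitAt⁻¹-↑ʳ; join-splitAt; ↑ˡ-injective; ↑ʳ-injective;
           toℕ-↑ˡ; toℕ-↑ʳ; toℕ<n)
    renaming (_≟_ to _≟ᶠ_)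
  open import Data.List using (List; []; _∷_; length; map; _++_)
  open import Data.List.Membership.Propositional using (_∈_)
  open import Data.List.Membership.Propositional.Properties using (∈-map⁺; ∈-map⁻; ∈-++⁺ˡ; ∈-++⁺ʳ; ∈-++⁻)
  open import Data.List.Properties using (length-++; length-map; concatMap-++)
  open import Data.List.Relation.Unary.All as All using (All)
  import Data.List.Relation.Unary.All.Properties as All
  open import Data.List.Relation.Unary.Unique.Propositional using (Unique)
  import Data.List.Relation.Unary.Unique.Propositional.Properties as Unique
  open import Data.List.Relation.Binary.Disjoint.Propositional using (Disjoint)
  open import Data.Nat using (ℕ; _<_; _+_)
  open import Data.Nat.Properties using (<-≤-trans; m≤m+n; +-monoʳ-<; +-cancelˡ-<; <⇒≢; <-asym)
  open import Data.Product using (∃-syntax; _×_; _,_; proj₁; proj₂)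
  open import Data.Rational using (ℚ; 0ℚ; 1ℚ; -_) renaming (_+_ to _+ℚ_; _*_ to _*ℚ_)
  open import Data.Sum using (_⊎_; inj₁; inj₂)
  import Data.Vec.Functional as Vector
  open import Data.Vec.Functional.Properties using (lookup-++ˡ; lookup-++ʳ)
  open import Function using (_∘_)
  open import Function.Bundles using (mk⇔)
  open import Relation.Binary.PropositionalEquality as ≡
    using (_≡_; _≢_; refl; cong; cong₂; subst; subst₂; module ≡-Reasoning)
  open import Relation.Nullary using (Dec; yes; no; does)
  open import Relation.Nullary.Decidable using (dec-true; dec-false; does-⇔)
  open import Tactic.RingSolver using (solve-∀)

  does-true : ∀ {A : Set} (d : Dec A) → does d ≡ true → A
  does-true (yes a) _ = a

  map-disjoint : ∀ {A B C : Set} {f : A → C} {g : B → C} → (∀ x y → f x ≢ g y) →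
                 ∀ {xs ys} → Disjoint (map f xs) (map g ys)
  map-disjoint f≢g (v∈fxs , v∈gys) with ∈-map⁻ _ v∈fxs | ∈-map⁻ _ v∈gys
  ... | x , _ , refl | y , _ , fx≡gy = f≢g x y fx≡gy

  both : ∀ {A B : Set} → (A → B) → A × A → B × B
  both f (x , y) = f x , f y

  both-injective : ∀ {A B : Set} {f : A → B} → (∀ {x y} → f x ≡ f y → x ≡ y) →
                   ∀ {p q} → both f p ≡ both f q → p ≡ q
  both-injective f-inj {_ , _} {_ , _} e = cong₂ _,_ (f-inj (cong proj₁ e)) (f-inj (cong proj₂ e))

  Disjoint-++ʳ : ∀ {A : Set} {xs ys zs : List A} → Disjoint xs ys → Disjoint xs zs → Disjoint xs (ys ++ zs)
  Disjoint-++ʳ {ys = ys} xs#ys xs#zs (v∈xs , v∈ys++zs) with ∈-++⁻ ys v∈ys++zs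
  ... | inj₁ v∈ys = xs#ys (v∈xs , v∈ys)
  ... | inj₂ v∈zs = xs#zs (v∈xs , v∈zs)

  endpoints-both : ∀ {m n} (f : Fin m → Fin n) M → endpoints (map (both f) M) ≡ map f (endpoints M)
  endpoints-both f [] = refl
  endpoints-both f ((i , j) ∷ M) = cong (λ rest → f i ∷ f j ∷ rest) (endpoints-both f M)

  data Split (m n : ℕ) : Fin (m + n) → Set where
    inl : (a : Fin m) → Split m n (a ↑ˡ n)
    inr : (y : Fin n) → Split m n (m ↑ʳ y)

  split : ∀ m {n} (i : Fin (m + n)) → Split m n i
  split m {n} i with splitAt m i in eq
  ... | inj₁ a = subst (Split m n) (splitAt⁻¹-↑ˡ eq) (inl a)
  ... | inj₂ y = subst (Split m n) (splitAt⁻¹-↑ʳ eq) (inr y)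

  ↑ˡ<↑ʳ : ∀ {m n} (a : Fin m) (y : Fin n) → toℕ (a ↑ˡ n) < toℕ (m ↑ʳ y)
  ↑ˡ<↑ʳ {m} {n} a y rewrite toℕ-↑ˡ a n | toℕ-↑ʳ m y = <-≤-trans (toℕ<n a) (m≤m+n m (toℕ y))

  ↑ˡ-mono-< : ∀ {m} n {a b : Fin m} → toℕ a < toℕ b → toℕ (a ↑ˡ n) < toℕ (b ↑ˡ n)
  ↑ˡ-mono-< n {a} {b} = subst₂ _<_ (≡.sym (toℕ-↑ˡ a n)) (≡.sym (toℕ-↑ˡ b n))

  ↑ˡ-cancel-< : ∀ {m} n {a b : Fin m} → toℕ (a ↑ˡ n) < toℕ (b ↑ˡ n) → toℕ a < toℕ b
  ↑ˡ-cancel-< n {a} {b} = subst₂ _<_ (toℕ-↑ˡ a n) (toℕ-↑ˡ b n)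

  ↑ʳ-mono-< : ∀ m {n} {y z : Fin n} → toℕ y < toℕ z → toℕ (m ↑ʳ y) < toℕ (m ↑ʳ z)
  ↑ʳ-mono-< m {y = y} {z} y<z = subst₂ _<_ (≡.sym (toℕ-↑ʳ m y)) (≡.sym (toℕ-↑ʳ m z)) (+-monoʳ-< m y<z)

  ↑ʳ-cancel-< : ∀ m {n} {y z : Fin n} → toℕ (m ↑ʳ y) < toℕ (m ↑ʳ z) → toℕ y < toℕ z
  ↑ʳ-cancel-< m {y = y} {z} = +-cancelˡ-< m _ _ ∘ subst₂ _<_ (toℕ-↑ʳ m y) (toℕ-↑ʳ m z)

  ↑ˡ≢↑ʳ : ∀ {m n} (a : Fin m) (y : Fin n) → a ↑ˡ n ≢ m ↑ʳ y
  ↑ˡ≢↑ʳ a y a≡y = <⇒≢ (↑ˡ<↑ʳ a y) (cong toℕ a≡y)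

  splitAt-injective : ∀ m {n} {i j : Fin (m + n)} → splitAt m i ≡ splitAt m j → i ≡ j
  splitAt-injective m {n} {i} {j} e =
    ≡.trans (≡.sym (join-splitAt m n i)) (≡.trans (cong (join m n) e) (join-splitAt m n j))

  module Attach {nG nH : ℕ} (G : Graph nG) (hub : Fin nG) (H : Graph nH) (attachments : List (Fin nH)) where

    open import Data.List.Membership.DecPropositional (_≟ᶠ_ {nH}) using (_∈?_)

    isHub : Fin nG → Bool
    isHub a = does (a ≟ᶠ hub)

    isAttachment : Fin nH → Bool
    isAttachment y = does (y ∈? attachments)

    adj⊎ : Fin nG ⊎ Fin nH → Fin nG ⊎ Fin nH → Bool
    adj⊎ (inj₁ a) (inj₁ b) = adj G a b
    adj⊎ (inj₁ a) (inj₂ y) = isHub a ∧ isAttachment y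
    adj⊎ (inj₂ y) (inj₁ a) = isHub a ∧ isAttachment y
    adj⊎ (inj₂ y) (inj₂ z) = adj H y z

    adj⊎-sym : ∀ x y → adj⊎ x y ≡ adj⊎ y x
    adj⊎-sym (inj₁ a) (inj₁ b) = adj-sym G a b
    adj⊎-sym (inj₁ a) (inj₂ y) = refl
    adj⊎-sym (inj₂ y) (inj₁ a) = refl
    adj⊎-sym (inj₂ y) (inj₂ z) = adj-sym H y z

    adj⊎-irrefl : ∀ x → adj⊎ x x ≡ false
    adj⊎-irrefl (inj₁ a) = adj-irrefl G a
    adj⊎-irrefl (inj₂ y) = adj-irrefl H y

    glued : Graph (nG + nH)
    glued = record
      { adj = λ i j → adj⊎ (splitAt nG i) (splitAt nG j)
      ; adj-sym = λ i j → adj⊎-sym (splitAt nG i) (splitAt nG j)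
      ; adj-irrefl = λ i → adj⊎-irrefl (splitAt nG i)
      }

    ι₁ : Fin nG → Fin (nG + nH)
    ι₁ a = a ↑ˡ nH

    ι₂ : Fin nH → Fin (nG + nH)
    ι₂ y = nG ↑ʳ y

    adj-ι₁-ι₁ : ∀ a b → adj glued (ι₁ a) (ι₁ b) ≡ adj G a b
    adj-ι₁-ι₁ a b rewrite splitAt-↑ˡ nG a nH | splitAt-↑ˡ nG b nH = refl

    adj-ι₁-ι₂ : ∀ a y → adj glued (ι₁ a) (ι₂ y) ≡ isHub a ∧ isAttachment y
    adj-ι₁-ι₂ a y rewrite splitAt-↑ˡ nG a nH | splitAt-↑ʳ nG nH y = refl

    adj-ι₂-ι₁ : ∀ y a → adj glued (ι₂ y) (ι₁ a) ≡ isHub a ∧ isAttachment y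
    adj-ι₂-ι₁ y a rewrite splitAt-↑ˡ nG a nH | splitAt-↑ʳ nG nH y = refl

    adj-ι₂-ι₂ : ∀ y z → adj glued (ι₂ y) (ι₂ z) ≡ adj H y z
    adj-ι₂-ι₂ y z rewrite splitAt-↑ʳ nG nH y | splitAt-↑ʳ nG nH z = refl

    ι₁-Adj : ∀ {a b} → Adj (allPositive G) a b → Adj (allPositive glued) (ι₁ a) (ι₁ b)
    ι₁-Adj {a} {b} = subst (λ x → fromBool x ≢ none) (≡.sym (adj-ι₁-ι₁ a b))

    ι₂-Adj : ∀ {y z} → Adj (allPositive H) y z → Adj (allPositive glued) (ι₂ y) (ι₂ z)
    ι₂-Adj {y} {z} = subst (λ x → fromBool x ≢ none) (≡.sym (adj-ι₂-ι₂ y z))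

    isHub-hub : isHub hub ≡ true
    isHub-hub = dec-true (hub ≟ᶠ hub) refl

    hub-spoke : ∀ {y} → y ∈ attachments → adj glued (ι₁ hub) (ι₂ y) ≡ true
    hub-spoke {y} y∈att = ≡.trans (adj-ι₁-ι₂ hub y) (cong₂ _∧_ isHub-hub (dec-true (y ∈? attachments) y∈att))

    spoke-hub : ∀ {a y} → isHub a ∧ isAttachment y ≡ true → a ≡ hub × y ∈ attachments
    spoke-hub {a} {y} e with a ≟ᶠ hub | y ∈? attachments | e
    ... | yes a≡hub | yes y∈att | _ = a≡hub , y∈att
    ... | yes _ | no _ | ()
    ... | no _ | _ | ()

    reaches-hub : (∀ a → Reach (allPositive G) a hub) →
                  (∀ y → ∃[ z ] z ∈ attachments × Reach (allPositive H) y z) →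
                  ∀ i → Reach (allPositive glued) i (ι₁ hub)
    reaches-hub G-reaches H-reaches i with split nG i
    ... | inl a = Reach-map {allPositive G} {allPositive glued} ι₁ ι₁-Adj (G-reaches a)
    ... | inr y with H-reaches y
    ... | z , z∈att , y⇝z =
      Reach-trans (Reach-map {allPositive H} {allPositive glued} ι₂ ι₂-Adj y⇝z)
                  (step (true⇒fromBool≢none (≡.trans (adj-sym glued (ι₂ z) (ι₁ hub)) (hub-spoke z∈att))) here)

    module Edges {eG eH} (EG : EdgeList G eG) (EH : EdgeList H eH) (attachments-unique : Unique attachments) where

      private
        module EG = EdgeList EG
        module EH = EdgeList EH

      spoke : Fin nH → Fin (nG + nH) × Fin (nG + nH)
      spoke y = ι₁ hub , ι₂ y

      edges : List (Fin (nG + nH) × Fin (nG + nH))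
      edges = map (both ι₁) EG.edges ++ map (both ι₂) EH.edges ++ map spoke attachments

      edges-unique : Unique edges
      edges-unique =
        Unique.++⁺ (Unique.map⁺ (both-injective (↑ˡ-injective nH _ _)) EG.edges-unique)
          (Unique.++⁺ (Unique.map⁺ (both-injective (↑ʳ-injective nG _ _)) EH.edges-unique)
                      (Unique.map⁺ (↑ʳ-injective nG _ _ ∘ cong proj₂) attachments-unique)
                      (map-disjoint λ (y , _) _ e → ↑ˡ≢↑ʳ hub y (≡.sym (cong proj₁ e))))
          (Disjoint-++ʳ {ys = map (both ι₂) EH.edges}
                        (map-disjoint λ (a , _) (y , _) e → ↑ˡ≢↑ʳ a y (cong proj₁ e))
                        (map-disjoint λ (_ , b) y e → ↑ˡ≢↑ʳ b y (cong proj₂ e)))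

      edges-sound : All (λ (i , j) → toℕ i < toℕ j × adj glued i j ≡ true) edges
      edges-sound =
        All.++⁺ (All.map⁺ (All.map (λ {(a , b)} (a<b , e) → ↑ˡ-mono-< nH a<b , ≡.trans (adj-ι₁-ι₁ a b) e)
                                   EG.edges-sound))
          (All.++⁺ (All.map⁺ (All.map (λ {(y , z)} (y<z , e) → ↑ʳ-mono-< nG y<z , ≡.trans (adj-ι₂-ι₂ y z) e)
                                      EH.edges-sound))
                   (All.map⁺ (All.tabulate (λ {y} y∈att → ↑ˡ<↑ʳ hub y , hub-spoke y∈att))))

      edges-complete : ∀ i j → toℕ i < toℕ j → adj glued i j ≡ true → (i , j) ∈ edges
      edges-complete i j with split nG i | split nG j
      ... | inl a | inl b = λ a<b e →
        ∈-++⁺ˡ (∈-map⁺ (both ι₁)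
          (EG.edges-complete a b (↑ˡ-cancel-< nH a<b) (≡.trans (≡.sym (adj-ι₁-ι₁ a b)) e)))
      ... | inl a | inr y = λ _ e → spoke∈edges (spoke-hub (≡.trans (≡.sym (adj-ι₁-ι₂ a y)) e))
        where
        spoke∈edges : a ≡ hub × y ∈ attachments → (ι₁ a , ι₂ y) ∈ edges
        spoke∈edges (refl , y∈att) =
          ∈-++⁺ʳ (map (both ι₁) EG.edges) (∈-++⁺ʳ (map (both ι₂) EH.edges) (∈-map⁺ spoke y∈att))
      ... | inr y | inl a = λ y<a _ → ⊥-elim (<-asym y<a (↑ˡ<↑ʳ a y))
      ... | inr y | inr z = λ y<z e →
        ∈-++⁺ʳ (map (both ι₁) EG.edges) (∈-++⁺ˡ (∈-map⁺ (both ι₂)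
          (EH.edges-complete y z (↑ʳ-cancel-< nG y<z) (≡.trans (≡.sym (adj-ι₂-ι₂ y z)) e))))

      edges-length : length edges ≡ eG + (eH + length attachments)
      edges-length =
        ≡.trans (length-++ (map (both ι₁) EG.edges))
          (cong₂ _+_ (≡.trans (length-map (both ι₁) EG.edges) EG.edges-length)
                     (≡.trans (length-++ (map (both ι₂) EH.edges))
                              (cong₂ _+_ (≡.trans (length-map (both ι₂) EH.edges) EH.edges-length)
                                         (length-map spoke attachments))))

      edgeList : EdgeList glued (eG + (eH + length attachments))
      edgeList = record
        { edges = edges ; edges-unique = edges-unique ; edges-sound = edges-sound
        ; edges-complete = edges-complete ; edges-length = edges-length }

    module Pendant (leaf : Fin nG) (leaf-adj : ∀ j → adj G leaf j ≡ isHub j) where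

      leaf≢hub : leaf ≢ hub
      leaf≢hub leaf≡hub with ≡.trans (≡.sym isHub-hub) (≡.trans (≡.sym (leaf-adj hub))
                                (≡.trans (cong (λ x → adj G x hub) leaf≡hub) (adj-irrefl G hub)))
      ... | ()

      adj-leaf : ∀ a → adj G a leaf ≡ isHub a
      adj-leaf a = ≡.trans (adj-sym G a leaf) (leaf-adj a)

      hub-leaf : adj G hub leaf ≡ true
      hub-leaf = ≡.trans (adj-leaf hub) isHub-hub

      isHub-leaf : isHub leaf ≡ false
      isHub-leaf = dec-false (leaf ≟ᶠ hub) leaf≢hub

      leaf-adj⁺ : ∀ j → adj glued (ι₁ leaf) j ≡ does (j ≟ᶠ ι₁ hub)
      leaf-adj⁺ j with split nG j
      ... | inl b =
        ≡.trans (adj-ι₁-ι₁ leaf b)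
                (≡.trans (leaf-adj b) (does-⇔ (mk⇔ (cong ι₁) (↑ˡ-injective nH _ _)) (b ≟ᶠ hub) (ι₁ b ≟ᶠ ι₁ hub)))
      ... | inr y =
        ≡.trans (adj-ι₁-ι₂ leaf y)
                (≡.trans (cong (_∧ isAttachment y) isHub-leaf)
                         (≡.sym (dec-false (ι₂ y ≟ᶠ ι₁ hub) (↑ˡ≢↑ʳ hub y ∘ ≡.sym))))

      leaf-neighbour : ∀ {j} → adj G leaf j ≡ true → j ≡ hub
      leaf-neighbour {j} e = does-true (j ≟ᶠ hub) (≡.trans (≡.sym (leaf-adj j)) e)

      module Matchings {mG mH} (MG : MaximumMatching G mG) (MH : MaximumMatching H mH) where

        private
          module MG = MaximumMatching MG
          module MH = MaximumMatching MH
          module CG = IntersectingCover MG.cover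
          module CH = IntersectingCover MH.cover

        matching : List (Fin (nG + nH) × Fin (nG + nH))
        matching = map (both ι₁) MG.matching ++ map (both ι₂) MH.matching

        matching-valid : IsMatchingᴳ glued matching
        matching-valid =
          All.++⁺ (All.map⁺ (All.map (λ {(a , b)} e → ≡.trans (adj-ι₁-ι₁ a b) e) (proj₁ MG.matching-valid)))
                  (All.map⁺ (All.map (λ {(y , z)} e → ≡.trans (adj-ι₂-ι₂ y z) e) (proj₁ MH.matching-valid))) ,
          subst Unique (≡.sym endpoints-matching)
            (Unique.++⁺ (Unique.map⁺ (↑ˡ-injective nH _ _) (proj₂ MG.matching-valid))
                        (Unique.map⁺ (↑ʳ-injective nG _ _) (proj₂ MH.matching-valid))
                        (map-disjoint ↑ˡ≢↑ʳ))
          where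
          endpoints-matching : endpoints matching ≡ map ι₁ (endpoints MG.matching) ++ map ι₂ (endpoints MH.matching)
          endpoints-matching =
            ≡.trans (concatMap-++ _ (map (both ι₁) MG.matching) (map (both ι₂) MH.matching))
                    (cong₂ _++_ (endpoints-both ι₁ MG.matching) (endpoints-both ι₂ MH.matching))

        -- All spokes join the class of hℓ: every G-edge in that class meets hℓ, hence contains h
        -- because ℓ is pendant, so the whole class still passes through h.
        hubClass : Fin (mG + mH)
        hubClass = CG.class hub leaf hub-leaf ↑ˡ mH

        class⊎ : ∀ x y → adj⊎ x y ≡ true → Fin (mG + mH)
        class⊎ (inj₁ a) (inj₁ b) e = CG.class a b e ↑ˡ mH
        class⊎ (inj₂ y) (inj₂ z) e = mG ↑ʳ CH.class y z e
        class⊎ _ _ _ = hubClass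

        HasHub : Fin nG ⊎ Fin nH → Fin nG ⊎ Fin nH → Set
        HasHub x y = x ≡ inj₁ hub ⊎ y ≡ inj₁ hub

        hubClass⇒HasHub : ∀ x y e → class⊎ x y e ≡ hubClass → HasHub x y
        hubClass⇒HasHub (inj₁ a) (inj₁ b) e same =
          meets-hub-leaf (CG.class-meet e hub-leaf (↑ˡ-injective mH _ _ same))
          where
          meets-hub-leaf : Meet a b hub leaf → HasHub (inj₁ a) (inj₁ b)
          meets-hub-leaf (inj₁ a≡hub) = inj₁ (cong inj₁ a≡hub)
          meets-hub-leaf (inj₂ (inj₁ refl)) = inj₂ (cong inj₁ (leaf-neighbour e))
          meets-hub-leaf (inj₂ (inj₂ (inj₁ b≡hub))) = inj₂ (cong inj₁ b≡hub)
          meets-hub-leaf (inj₂ (inj₂ (inj₂ refl))) = inj₁ (cong inj₁ (leaf-neighbour (≡.trans (adj-sym G leaf a) e)))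
        hubClass⇒HasHub (inj₁ a) (inj₂ y) e _ = inj₁ (cong inj₁ (proj₁ (spoke-hub e)))
        hubClass⇒HasHub (inj₂ y) (inj₁ a) e _ = inj₂ (cong inj₁ (proj₁ (spoke-hub e)))
        hubClass⇒HasHub (inj₂ y) (inj₂ z) e same = ⊥-elim (↑ˡ≢↑ʳ _ _ (≡.sym same))

        HasHub-meet : ∀ {x y x′ y′} → HasHub x y → HasHub x′ y′ → Meet x y x′ y′
        HasHub-meet (inj₁ x≡hub) (inj₁ x′≡hub) = inj₁ (≡.trans x≡hub (≡.sym x′≡hub))
        HasHub-meet (inj₁ x≡hub) (inj₂ y′≡hub) = inj₂ (inj₁ (≡.trans x≡hub (≡.sym y′≡hub)))
        HasHub-meet (inj₂ y≡hub) (inj₁ x′≡hub) = inj₂ (inj₂ (inj₁ (≡.trans y≡hub (≡.sym x′≡hub))))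
        HasHub-meet (inj₂ y≡hub) (inj₂ y′≡hub) = inj₂ (inj₂ (inj₂ (≡.trans y≡hub (≡.sym y′≡hub))))

        meet-via-hub : ∀ x y e x′ y′ e′ → class⊎ x y e ≡ hubClass → class⊎ x y e ≡ class⊎ x′ y′ e′ →
                       Meet x y x′ y′
        meet-via-hub x y e x′ y′ e′ class≡hub same =
          HasHub-meet (hubClass⇒HasHub x y e class≡hub) (hubClass⇒HasHub x′ y′ e′ (≡.trans (≡.sym same) class≡hub))

        class⊎-meet : ∀ x y x′ y′ e e′ → class⊎ x y e ≡ class⊎ x′ y′ e′ → Meet x y x′ y′
        class⊎-meet (inj₁ a) (inj₁ b) (inj₁ a′) (inj₁ b′) e e′ same =
          Meet-map inj₁ (CG.class-meet e e′ (↑ˡ-injective mH _ _ same))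
        class⊎-meet (inj₂ y) (inj₂ z) (inj₂ y′) (inj₂ z′) e e′ same =
          Meet-map inj₂ (CH.class-meet e e′ (↑ʳ-injective mG _ _ same))
        class⊎-meet (inj₁ a) (inj₁ b) (inj₂ y′) (inj₂ z′) e e′ same = ⊥-elim (↑ˡ≢↑ʳ _ _ same)
        class⊎-meet (inj₂ y) (inj₂ z) (inj₁ a′) (inj₁ b′) e e′ same = ⊥-elim (↑ˡ≢↑ʳ _ _ (≡.sym same))
        class⊎-meet x@(inj₁ _) y@(inj₂ _) x′ y′ e e′ same = meet-via-hub x y e x′ y′ e′ refl same
        class⊎-meet x@(inj₂ _) y@(inj₁ _) x′ y′ e e′ same = meet-via-hub x y e x′ y′ e′ refl same
        class⊎-meet x y x′@(inj₁ _) y′@(inj₂ _) e e′ same = meet-via-hub x y e x′ y′ e′ same same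
        class⊎-meet x y x′@(inj₂ _) y′@(inj₁ _) e e′ same = meet-via-hub x y e x′ y′ e′ same same

        cover : IntersectingCover glued (mG + mH)
        cover = record
          { class = λ i j → class⊎ (splitAt nG i) (splitAt nG j)
          ; class-meet = λ e e′ same → Meet-injective (splitAt-injective nG) (class⊎-meet _ _ _ _ e e′ same)
          }

        maximumMatching : MaximumMatching glued (mG + mH)
        maximumMatching = record
          { matching = matching
          ; matching-valid = matching-valid
          ; matching-length = ≡.trans (length-++ (map (both ι₁) MG.matching))
                                      (cong₂ _+_ (≡.trans (length-map _ MG.matching) MG.matching-length)
                                                 (≡.trans (length-map _ MH.matching) MH.matching-length))
          ; cover = cover
          }

      module Kernel {ηG ηH} (PG : PivotBasis (allPositive G) ηG) (leaf∉pivots : ∀ l → PivotBasis.pivot PG l ≢ leaf)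
                    (PH : PivotBasis (allPositive H) ηH) where

        private
          module PG = PivotBasis PG
          module PH = PivotBasis PH
          Aᴳ = A (allPositive G)
          Aᴴ = A (allPositive H)
          A⁺ = A (allPositive glued)

        attSum : (Fin nH → ℚ) → ℚ
        attSum w = sumFin (λ y → 𝟙 (isAttachment y) *ℚ w y)

        row-ι₁ : ∀ v a → (A⁺ *ᵥ v) (ι₁ a) ≡ (Aᴳ *ᵥ (v ∘ ι₁)) a +ℚ 𝟙 (isHub a) *ℚ attSum (v ∘ ι₂)
        row-ι₁ v a = begin
          (A⁺ *ᵥ v) (ι₁ a)
            ≡⟨ sumFin-↑ nG (λ j → A⁺ (ι₁ a) j *ℚ v j) ⟩
          sumFin (λ b → A⁺ (ι₁ a) (ι₁ b) *ℚ v (ι₁ b)) +ℚ sumFin (λ y → A⁺ (ι₁ a) (ι₂ y) *ℚ v (ι₂ y))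
            ≡⟨ cong₂ _+ℚ_ (sumFin-cong λ b → cong (λ x → 𝟙 x *ℚ v (ι₁ b)) (adj-ι₁-ι₁ a b))
                          (sumFin-cong λ y → ≡.trans (cong (λ x → 𝟙 x *ℚ v (ι₂ y)) (adj-ι₁-ι₂ a y))
                                                     (𝟙-∧-* (isHub a) (isAttachment y) (v (ι₂ y)))) ⟩
          (Aᴳ *ᵥ (v ∘ ι₁)) a +ℚ sumFin (λ y → 𝟙 (isHub a) *ℚ (𝟙 (isAttachment y) *ℚ v (ι₂ y)))
            ≡⟨ cong ((Aᴳ *ᵥ (v ∘ ι₁)) a +ℚ_) (*-distribˡ-sumFin (𝟙 (isHub a)) (λ y → 𝟙 (isAttachment y) *ℚ v (ι₂ y)))
             ⟨
          (Aᴳ *ᵥ (v ∘ ι₁)) a +ℚ 𝟙 (isHub a) *ℚ attSum (v ∘ ι₂)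
            ∎
          where open ≡-Reasoning

        row-ι₂ : ∀ v y → (A⁺ *ᵥ v) (ι₂ y) ≡ 𝟙 (isAttachment y) *ℚ v (ι₁ hub) +ℚ (Aᴴ *ᵥ (v ∘ ι₂)) y
        row-ι₂ v y = begin
          (A⁺ *ᵥ v) (ι₂ y)
            ≡⟨ sumFin-↑ nG (λ j → A⁺ (ι₂ y) j *ℚ v j) ⟩
          sumFin (λ a → A⁺ (ι₂ y) (ι₁ a) *ℚ v (ι₁ a)) +ℚ sumFin (λ z → A⁺ (ι₂ y) (ι₂ z) *ℚ v (ι₂ z))
            ≡⟨ cong₂ _+ℚ_ (sumFin-cong λ a → ≡.trans (cong (λ x → 𝟙 x *ℚ v (ι₁ a)) (adj-ι₂-ι₁ y a))
                                                     (𝟙-∧-* (isHub a) (isAttachment y) (v (ι₁ a))))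
                          (sumFin-cong λ z → cong (λ x → 𝟙 x *ℚ v (ι₂ z)) (adj-ι₂-ι₂ y z)) ⟩
          sumFin (λ a → 𝟙 (isHub a) *ℚ (𝟙 (isAttachment y) *ℚ v (ι₁ a))) +ℚ (Aᴴ *ᵥ (v ∘ ι₂)) y
            ≡⟨ cong (_+ℚ (Aᴴ *ᵥ (v ∘ ι₂)) y) (sumFin-sift hub (λ a → 𝟙 (isAttachment y) *ℚ v (ι₁ a))) ⟩
          𝟙 (isAttachment y) *ℚ v (ι₁ hub) +ℚ (Aᴴ *ᵥ (v ∘ ι₂)) y
            ∎
          where open ≡-Reasoning

        row-leaf : ∀ u → (Aᴳ *ᵥ u) leaf ≡ u hub
        row-leaf u = ≡.trans (sumFin-cong (λ j → cong (λ x → 𝟙 x *ℚ u j) (leaf-adj j))) (sumFin-sift hub u)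

        kernel⇒hub-zero : ∀ u → InKernel (allPositive G) u → u hub ≡ 0ℚ
        kernel⇒hub-zero u u∈ker = ≡.trans (≡.sym (row-leaf u)) (u∈ker leaf)

        leafVector : ℚ → Fin nG → ℚ
        leafVector c a = 𝟙 (does (a ≟ᶠ leaf)) *ℚ c

        leafVector-≢ : ∀ c {a} → a ≢ leaf → leafVector c a ≡ 0ℚ
        leafVector-≢ c {a} a≢leaf = 𝟙-false-* c (dec-false (a ≟ᶠ leaf) a≢leaf)

        column-leaf : ∀ c a → (Aᴳ *ᵥ leafVector c) a ≡ 𝟙 (isHub a) *ℚ c
        column-leaf c a = begin
          sumFin (λ b → 𝟙 (adj G a b) *ℚ (𝟙 (does (b ≟ᶠ leaf)) *ℚ c))
            ≡⟨ sumFin-cong (λ b → swap (𝟙 (adj G a b)) (𝟙 (does (b ≟ᶠ leaf))) c) ⟩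
          sumFin (λ b → 𝟙 (does (b ≟ᶠ leaf)) *ℚ (𝟙 (adj G a b) *ℚ c))
            ≡⟨ sumFin-sift leaf (λ b → 𝟙 (adj G a b) *ℚ c) ⟩
          𝟙 (adj G a leaf) *ℚ c
            ≡⟨ cong (λ x → 𝟙 x *ℚ c) (adj-leaf a) ⟩
          𝟙 (isHub a) *ℚ c
            ∎
          where
          open ≡-Reasoning
          swap : ∀ x y z → x *ℚ (y *ℚ z) ≡ y *ℚ (x *ℚ z)
          swap = solve-∀ ℚ-ring

        extendG : (Fin nG → ℚ) → Fin (nG + nH) → ℚ
        extendG u = u Vector.++ (λ _ → 0ℚ)

        -- The leaf entry cancels, in the hub's row, what w contributes through the spokes;
        -- no other row sees it, since the leaf is adjacent to the hub only.
        extendH : (Fin nH → ℚ) → Fin (nG + nH) → ℚ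
        extendH w = leafVector (- attSum w) Vector.++ w

        extendG-kernel : ∀ u → InKernel (allPositive G) u → InKernel (allPositive glued) (extendG u)
        extendG-kernel u u∈ker i with split nG i
        ... | inl a = begin
          (A⁺ *ᵥ extendG u) (ι₁ a)
            ≡⟨ row-ι₁ (extendG u) a ⟩
          (Aᴳ *ᵥ (extendG u ∘ ι₁)) a +ℚ 𝟙 (isHub a) *ℚ attSum (extendG u ∘ ι₂)
            ≡⟨ +-eliminateʳ _ (*-vanishʳ (𝟙 (isHub a)) (sumFin-zeroʳ (𝟙 ∘ isAttachment) (lookup-++ʳ u _))) ⟩
          (Aᴳ *ᵥ (extendG u ∘ ι₁)) a
            ≡⟨ *ᵥ-cong Aᴳ (lookup-++ˡ u _) a ⟩
          (Aᴳ *ᵥ u) a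
            ≡⟨ u∈ker a ⟩
          0ℚ
            ∎
          where open ≡-Reasoning
        ... | inr y = begin
          (A⁺ *ᵥ extendG u) (ι₂ y)
            ≡⟨ row-ι₂ (extendG u) y ⟩
          𝟙 (isAttachment y) *ℚ extendG u (ι₁ hub) +ℚ (Aᴴ *ᵥ (extendG u ∘ ι₂)) y
            ≡⟨ +-eliminateˡ _ (*-vanishʳ (𝟙 (isAttachment y))
                                          (≡.trans (lookup-++ˡ u _ hub) (kernel⇒hub-zero u u∈ker))) ⟩
          (Aᴴ *ᵥ (extendG u ∘ ι₂)) y
            ≡⟨ sumFin-zeroʳ (Aᴴ y) (lookup-++ʳ u _) ⟩
          0ℚ
            ∎
          where open ≡-Reasoning

        extendH-kernel : ∀ w → InKernel (allPositive H) w → InKernel (allPositive glued) (extendH w)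
        extendH-kernel w w∈ker i with split nG i
        ... | inl a = begin
          (A⁺ *ᵥ extendH w) (ι₁ a)
            ≡⟨ row-ι₁ (extendH w) a ⟩
          (Aᴳ *ᵥ (extendH w ∘ ι₁)) a +ℚ 𝟙 (isHub a) *ℚ attSum (extendH w ∘ ι₂)
            ≡⟨ cong₂ (λ x y → x +ℚ 𝟙 (isHub a) *ℚ y)
                     (*ᵥ-cong Aᴳ (lookup-++ˡ (leafVector _) w) a)
                     (sumFin-cong (λ y → cong (𝟙 (isAttachment y) *ℚ_) (lookup-++ʳ (leafVector _) w y))) ⟩
          (Aᴳ *ᵥ leafVector (- attSum w)) a +ℚ 𝟙 (isHub a) *ℚ attSum w
            ≡⟨ cong (_+ℚ 𝟙 (isHub a) *ℚ attSum w) (column-leaf (- attSum w) a) ⟩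
          𝟙 (isHub a) *ℚ (- attSum w) +ℚ 𝟙 (isHub a) *ℚ attSum w
            ≡⟨ cancel (𝟙 (isHub a)) (attSum w) ⟩
          0ℚ
            ∎
          where
          open ≡-Reasoning
          cancel : ∀ x s → x *ℚ (- s) +ℚ x *ℚ s ≡ 0ℚ
          cancel = solve-∀ ℚ-ring
        ... | inr y = begin
          (A⁺ *ᵥ extendH w) (ι₂ y)
            ≡⟨ row-ι₂ (extendH w) y ⟩
          𝟙 (isAttachment y) *ℚ extendH w (ι₁ hub) +ℚ (Aᴴ *ᵥ (extendH w ∘ ι₂)) y
            ≡⟨ +-eliminateˡ _ (*-vanishʳ (𝟙 (isAttachment y))
                                          (≡.trans (lookup-++ˡ (leafVector _) w hub) (leafVector-≢ _ (leaf≢hub ∘ ≡.sym)))) ⟩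
          (Aᴴ *ᵥ (extendH w ∘ ι₂)) y
            ≡⟨ *ᵥ-cong Aᴴ (lookup-++ʳ (leafVector _) w) y ⟩
          (Aᴴ *ᵥ w) y
            ≡⟨ w∈ker y ⟩
          0ℚ
            ∎
          where open ≡-Reasoning

        pivot : Fin (ηG + ηH) → Fin (nG + nH)
        pivot = (ι₁ ∘ PG.pivot) Vector.++ (ι₂ ∘ PH.pivot)

        basis : Fin (ηG + ηH) → Fin (nG + nH) → ℚ
        basis = (extendG ∘ PG.basis) Vector.++ (extendH ∘ PH.basis)

        pivot-ι₁ : ∀ k → pivot (k ↑ˡ ηH) ≡ ι₁ (PG.pivot k)
        pivot-ι₁ = lookup-++ˡ (ι₁ ∘ PG.pivot) (ι₂ ∘ PH.pivot)

        pivot-ι₂ : ∀ k → pivot (ηG ↑ʳ k) ≡ ι₂ (PH.pivot k)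
        pivot-ι₂ = lookup-++ʳ (ι₁ ∘ PG.pivot) (ι₂ ∘ PH.pivot)

        basis-ι₁ : ∀ k → basis (k ↑ˡ ηH) ≡ extendG (PG.basis k)
        basis-ι₁ = lookup-++ˡ (extendG ∘ PG.basis) (extendH ∘ PH.basis)

        basis-ι₂ : ∀ k → basis (ηG ↑ʳ k) ≡ extendH (PH.basis k)
        basis-ι₂ = lookup-++ʳ (extendG ∘ PG.basis) (extendH ∘ PH.basis)

        basis-pivot : ∀ k → basis k (pivot k) ≡ 1ℚ
        basis-pivot k with split ηG k
        ... | inl k rewrite basis-ι₁ k | pivot-ι₁ k = ≡.trans (lookup-++ˡ (PG.basis k) _ _) (PG.basis-pivot k)
        ... | inr k rewrite basis-ι₂ k | pivot-ι₂ k = ≡.trans (lookup-++ʳ (leafVector _) (PH.basis k) _) (PH.basis-pivot k)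

        basis-pivot-≢ : ∀ {k l} → k ≢ l → basis k (pivot l) ≡ 0ℚ
        basis-pivot-≢ {k} {l} k≢l with split ηG k | split ηG l
        ... | inl k | inl l rewrite basis-ι₁ k | pivot-ι₁ l =
          ≡.trans (lookup-++ˡ (PG.basis k) _ _) (PG.basis-pivot-≢ (k≢l ∘ cong (_↑ˡ ηH)))
        ... | inl k | inr l rewrite basis-ι₁ k | pivot-ι₂ l = lookup-++ʳ (PG.basis k) _ _
        ... | inr k | inl l rewrite basis-ι₂ k | pivot-ι₁ l =
          ≡.trans (lookup-++ˡ (leafVector _) (PH.basis k) _) (leafVector-≢ _ (leaf∉pivots l))
        ... | inr k | inr l rewrite basis-ι₂ k | pivot-ι₂ l =
          ≡.trans (lookup-++ʳ (leafVector _) (PH.basis k) _) (PH.basis-pivot-≢ (k≢l ∘ cong (ηG ↑ʳ_)))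

        basis-kernel : ∀ k → InKernel (allPositive glued) (basis k)
        basis-kernel k with split ηG k
        ... | inl k rewrite basis-ι₁ k = extendG-kernel (PG.basis k) (PG.basis-kernel k)
        ... | inr k rewrite basis-ι₂ k = extendH-kernel (PH.basis k) (PH.basis-kernel k)

        kernel-determined : ∀ v → InKernel (allPositive glued) v → (∀ l → v (pivot l) ≡ 0ℚ) → ∀ i → v i ≡ 0ℚ
        kernel-determined v v∈ker v-pivots≡0 = determined
          where
          open ≡-Reasoning
          vG = v ∘ ι₁
          vH = v ∘ ι₂
          v-hub≡0 : v (ι₁ hub) ≡ 0ℚ
          v-hub≡0 = begin
            v (ι₁ hub)                                          ≡⟨ row-leaf vG ⟨
            (Aᴳ *ᵥ vG) leaf                                     ≡⟨ +-eliminateʳ _ (𝟙-false-* (attSum vH) isHub-leaf) ⟨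
            (Aᴳ *ᵥ vG) leaf +ℚ 𝟙 (isHub leaf) *ℚ attSum vH      ≡⟨ row-ι₁ v leaf ⟨
            (A⁺ *ᵥ v) (ι₁ leaf)                                 ≡⟨ v∈ker (ι₁ leaf) ⟩
            0ℚ                                                  ∎
          vH∈ker : InKernel (allPositive H) vH
          vH∈ker y = begin
            (Aᴴ *ᵥ vH) y                                        ≡⟨ +-eliminateˡ _ (*-vanishʳ (𝟙 (isAttachment y)) v-hub≡0) ⟨
            𝟙 (isAttachment y) *ℚ v (ι₁ hub) +ℚ (Aᴴ *ᵥ vH) y    ≡⟨ row-ι₂ v y ⟨
            (A⁺ *ᵥ v) (ι₂ y)                                    ≡⟨ v∈ker (ι₂ y) ⟩
            0ℚ                                                  ∎
          vH≡0 : ∀ y → v (ι₂ y) ≡ 0ℚ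
          vH≡0 = PH.kernel-determined vH vH∈ker (λ l → ≡.trans (cong v (≡.sym (pivot-ι₂ l))) (v-pivots≡0 (ηG ↑ʳ l)))
          vG∈ker : InKernel (allPositive G) vG
          vG∈ker a = begin
            (Aᴳ *ᵥ vG) a                                        ≡⟨ +-eliminateʳ _ H-term≡0 ⟨
            (Aᴳ *ᵥ vG) a +ℚ 𝟙 (isHub a) *ℚ attSum vH            ≡⟨ row-ι₁ v a ⟨
            (A⁺ *ᵥ v) (ι₁ a)                                    ≡⟨ v∈ker (ι₁ a) ⟩
            0ℚ                                                  ∎
            where
            H-term≡0 = *-vanishʳ (𝟙 (isHub a)) (sumFin-zeroʳ (𝟙 ∘ isAttachment) vH≡0)
          vG≡0 : ∀ a → v (ι₁ a) ≡ 0ℚ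
          vG≡0 = PG.kernel-determined vG vG∈ker (λ l → ≡.trans (cong v (≡.sym (pivot-ι₁ l))) (v-pivots≡0 (l ↑ˡ ηH)))
          determined : ∀ i → v i ≡ 0ℚ
          determined i with split nG i
          ... | inl a = vG≡0 a
          ... | inr y = vH≡0 y

        pivotBasis : PivotBasis (allPositive glued) (ηG + ηH)
        pivotBasis = record
          { pivot = pivot ; basis = basis ; basis-pivot = basis-pivot ; basis-pivot-≢ = basis-pivot-≢
          ; basis-kernel = basis-kernel ; kernel-determined = kernel-determined }

        leaf∉pivots⁺ : ∀ l → pivot l ≢ ι₁ leaf
        leaf∉pivots⁺ l with split ηG l
        ... | inl l rewrite pivot-ι₁ l = leaf∉pivots l ∘ ↑ˡ-injective nH _ _
        ... | inr l rewrite pivot-ι₂ l = ↑ˡ≢↑ʳ leaf (PH.pivot l) ∘ ≡.sym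

  record Rooted (n e m η : ℕ) : Set where
    field
      graph : Graph n
      invariants : Invariants graph e m η
      hub leaf : Fin n
      leaf-adj : ∀ j → adj graph leaf j ≡ does (j ≟ᶠ hub)
      -- Kernel vectors lifted from a gadget are nonzero at the leaf, so it must not be a pivot.
      leaf∉pivots : ∀ l → PivotBasis.pivot (Invariants.pivotBasis invariants) l ≢ leaf
      reaches-hub : ∀ i → Reach (allPositive graph) i hub

  record Gadget (n e m η t : ℕ) : Set where
    field
      graph : Graph n
      invariants : Invariants graph e m η
      attachments : List (Fin n)
      attachments-unique : Unique attachments
      attachments-length : length attachments ≡ t
      reaches-attachment : ∀ y → ∃[ z ] z ∈ attachments × Reach (allPositive graph) y z

  attach : ∀ {nG eG mG ηG nH eH mH ηH t} → Rooted nG eG mG ηG → Gadget nH eH mH ηH t →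
           Rooted (nG + nH) (eG + (eH + t)) (mG + mH) (ηG + ηH)
  attach {eG = eG} {eH = eH} R D = record
    { graph = glued
    ; invariants = record
      { edgeList = subst (λ t → EdgeList glued (eG + (eH + t))) D.attachments-length edgeList
      ; maximumMatching = maximumMatching
      ; pivotBasis = pivotBasis
      }
    ; hub = ι₁ R.hub
    ; leaf = ι₁ R.leaf
    ; leaf-adj = leaf-adj⁺
    ; leaf∉pivots = leaf∉pivots⁺
    ; reaches-hub = reaches-hub R.reaches-hub D.reaches-attachment
    }
    where
    module R = Rooted R
    module D = Gadget D
    open Attach R.graph R.hub D.graph D.attachments
    open Edges (Invariants.edgeList R.invariants) (Invariants.edgeList D.invariants) D.attachments-unique
    open Pendant R.leaf R.leaf-adj
    open Matchings (Invariants.maximumMatching R.invariants) (Invariants.maximumMatching D.invariants)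
    open Kernel (Invariants.pivotBasis R.invariants) R.leaf∉pivots (Invariants.pivotBasis D.invariants)

module Gadgets where

  open LinearAlgebra
  open Graphs
  open Attachment
  open import Data.Bool using (Bool; true; false; not; _xor_; if_then_else_)
  import Data.Bool.Properties as Bool
  open import Data.Empty using (⊥-elim)
  open import Data.Fin using (Fin; toℕ; quotient)
  open import Data.Fin.Patterns using (0F; 1F; 2F; 3F)
  open import Data.Fin.Properties using (all?) renaming (_≟_ to _≟ᶠ_)
  open import Data.List using (List; []; _∷_; length)
  open import Data.List.Membership.Propositional using (_∈_)
  open import Data.List.Relation.Unary.Any using (here; there)
  import Data.List.Relation.Unary.All as All
  open import Data.List.Relation.Unary.Unique.Propositional using ([]; _∷_)
  open import Data.Nat using (_<_; _<?_)
  open import Data.Product using (_×_; _,_; proj₁; proj₂)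
  open import Data.Product.Properties using (≡-dec)
  open import Data.Rational using (ℚ; 0ℚ; 1ℚ; ½; -_; _+_; _*_; _-_)
  open import Function.Bundles using (mk⇔)
  open import Relation.Binary.PropositionalEquality as ≡ using (_≡_; refl; cong)
  open import Relation.Nullary using (Dec; does)
  open import Relation.Nullary.Decidable using (True; toWitness; dec-true; does-⇔; _×-dec_; _⊎-dec_; _→-dec_)
  open import Tactic.RingSolver using (solve-∀)

  complete : ∀ n → Graph n
  complete n = record
    { adj = λ i j → not (does (i ≟ᶠ j))
    ; adj-sym = λ i j → cong not (does-⇔ (mk⇔ ≡.sym ≡.sym) (i ≟ᶠ j) (j ≟ᶠ i))
    ; adj-irrefl = λ i → cong not (dec-true (i ≟ᶠ i) refl)
    }

  completeBipartite : ∀ {n} → (Fin n → Bool) → Graph n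
  completeBipartite side = record
    { adj = λ i j → side i xor side j
    ; adj-sym = λ i j → Bool.xor-comm (side i) (side j)
    ; adj-irrefl = λ i → Bool.xor-same (side i)
    }

  module Decide {n} (G : Graph n) where

    private
      _≟ₑ_ = ≡-dec (_≟ᶠ_ {n}) (_≟ᶠ_ {n})
      open import Data.List.Relation.Unary.Unique.DecPropositional _≟ₑ_ using (unique?)
      import Data.List.Relation.Unary.Unique.DecPropositional (_≟ᶠ_ {n}) as Vertices
      open import Data.List.Membership.DecPropositional _≟ₑ_ using (_∈?_)

      adj? : ∀ i j → Dec (adj G i j ≡ true)
      adj? i j = adj G i j Bool.≟ true

      sound? : ∀ e → Dec (toℕ (proj₁ e) < toℕ (proj₂ e) × adj G (proj₁ e) (proj₂ e) ≡ true)
      sound? (i , j) = (toℕ i <? toℕ j) ×-dec adj? i j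

      complete? : ∀ es → Dec (∀ i j → toℕ i < toℕ j → adj G i j ≡ true → (i , j) ∈ es)
      complete? es = all? λ i → all? λ j → (toℕ i <? toℕ j) →-dec (adj? i j →-dec ((i , j) ∈? es))

      meet? : (i j i′ j′ : Fin n) → Dec (Meet i j i′ j′)
      meet? i j i′ j′ = (i ≟ᶠ i′) ⊎-dec (i ≟ᶠ j′) ⊎-dec (j ≟ᶠ i′) ⊎-dec (j ≟ᶠ j′)

      meets? : ∀ {K} (class : Fin n → Fin n → Fin K) →
               Dec (∀ i j i′ j′ → adj G i j ≡ true → adj G i′ j′ ≡ true →
                    class i j ≡ class i′ j′ → Meet i j i′ j′)
      meets? class = all? λ i → all? λ j → all? λ i′ → all? λ j′ →
        adj? i j →-dec adj? i′ j′ →-dec (class i j ≟ᶠ class i′ j′) →-dec meet? i j i′ j′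

      valid? : ∀ M → Dec (IsMatchingᴳ G M)
      valid? M = All.all? (λ (i , j) → adj? i j) M ×-dec Vertices.unique? (endpoints M)

    edgeList : (es : List (Fin n × Fin n)) → {True (unique? es)} → {True (All.all? sound? es)} →
               {True (complete? es)} → EdgeList G (length es)
    edgeList es {u} {s} {c} = record
      { edges = es ; edges-unique = toWitness u ; edges-sound = toWitness s
      ; edges-complete = toWitness c ; edges-length = refl }

    maximumMatching : ∀ {K} (M : List (Fin n × Fin n)) (class : Fin n → Fin n → Fin K) →
                      {True (valid? M)} → {True (meets? class)} → length M ≡ K → MaximumMatching G K
    maximumMatching M class {v} {m} M-length = record
      { matching = M ; matching-valid = toWitness v ; matching-length = M-length
      ; cover = record { class = λ i j _ → class i j ; class-meet = λ e e′ → toWitness m _ _ _ _ e e′ } }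

  K₁-gadget : Gadget 1 0 0 1 1
  K₁-gadget = record
    { graph = complete 1
    ; invariants = record
      { edgeList = Decide.edgeList (complete 1) []
      ; maximumMatching = record
        { matching = [] ; matching-valid = All.[] , [] ; matching-length = refl
        ; cover = record { class = λ { 0F 0F () } ; class-meet = λ { {0F} {0F} () } } }
      ; pivotBasis = record
        { pivot = λ _ → 0F ; basis = λ _ _ → 1ℚ ; basis-pivot = λ _ → refl
        ; basis-pivot-≢ = λ { {0F} {0F} 0≢0 → ⊥-elim (0≢0 refl) }
        ; basis-kernel = λ { 0F 0F → refl }
        ; kernel-determined = λ { v _ v-pivot≡0 0F → v-pivot≡0 0F } }
      }
    ; attachments = 0F ∷ [] ; attachments-unique = All.[] ∷ [] ; attachments-length = refl
    ; reaches-attachment = λ { 0F → 0F , here refl , here }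
    }

  K₂-nonsingular : ∀ v → InKernel (allPositive (complete 2)) v → ∀ i → v i ≡ 0ℚ
  K₂-nonsingular v v∈ker 0F = ≡.trans (row₁ (v 0F) (v 1F)) (v∈ker 1F)
    where
    row₁ : ∀ x y → x ≡ 1ℚ * x + (0ℚ * y + 0ℚ)
    row₁ = solve-∀ ℚ-ring
  K₂-nonsingular v v∈ker 1F = ≡.trans (row₀ (v 0F) (v 1F)) (v∈ker 0F)
    where
    row₀ : ∀ x y → y ≡ 0ℚ * x + (1ℚ * y + 0ℚ)
    row₀ = solve-∀ ℚ-ring

  K₂-invariants : Invariants (complete 2) 1 1 0
  K₂-invariants = record
    { edgeList = Decide.edgeList (complete 2) ((0F , 1F) ∷ [])
    ; maximumMatching = Decide.maximumMatching (complete 2) ((0F , 1F) ∷ []) (λ _ _ → 0F) refl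
    ; pivotBasis = nonsingular⇒PivotBasis K₂-nonsingular
    }

  K₂-gadget : Gadget 2 1 1 0 2
  K₂-gadget = record
    { graph = complete 2
    ; invariants = K₂-invariants
    ; attachments = 0F ∷ 1F ∷ [] ; attachments-unique = ((λ ()) All.∷ All.[]) ∷ All.[] ∷ [] ; attachments-length = refl
    ; reaches-attachment = λ { 0F → 0F , here refl , here ; 1F → 1F , there (here refl) , here }
    }

  K₂-rooted : Rooted 2 1 1 0
  K₂-rooted = record
    { graph = complete 2
    ; invariants = K₂-invariants
    ; hub = 0F
    ; leaf = 1F
    ; leaf-adj = λ { 0F → refl ; 1F → refl }
    ; leaf∉pivots = λ ()
    ; reaches-hub = λ { 0F → here ; 1F → step (λ ()) here }
    }

  half-combination : ∀ {x y z} → x ≡ 0ℚ → y ≡ 0ℚ → z ≡ 0ℚ → ½ * (x + y - z) ≡ 0ℚ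
  half-combination refl refl refl = refl

  K₃-nonsingular : ∀ v → InKernel (allPositive (complete 3)) v → ∀ i → v i ≡ 0ℚ
  K₃-nonsingular v v∈ker 0F =
    ≡.trans (via-rows (v 0F) (v 1F) (v 2F)) (half-combination (v∈ker 1F) (v∈ker 2F) (v∈ker 0F))
    where
    via-rows : ∀ a b c → a ≡ ½ * ((1ℚ * a + (0ℚ * b + (1ℚ * c + 0ℚ))) + (1ℚ * a + (1ℚ * b + (0ℚ * c + 0ℚ)))
                                  - (0ℚ * a + (1ℚ * b + (1ℚ * c + 0ℚ))))
    via-rows = solve-∀ ℚ-ring
  K₃-nonsingular v v∈ker 1F =
    ≡.trans (via-rows (v 0F) (v 1F) (v 2F)) (half-combination (v∈ker 0F) (v∈ker 2F) (v∈ker 1F))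
    where
    via-rows : ∀ a b c → b ≡ ½ * ((0ℚ * a + (1ℚ * b + (1ℚ * c + 0ℚ))) + (1ℚ * a + (1ℚ * b + (0ℚ * c + 0ℚ)))
                                  - (1ℚ * a + (0ℚ * b + (1ℚ * c + 0ℚ))))
    via-rows = solve-∀ ℚ-ring
  K₃-nonsingular v v∈ker 2F =
    ≡.trans (via-rows (v 0F) (v 1F) (v 2F)) (half-combination (v∈ker 0F) (v∈ker 1F) (v∈ker 2F))
    where
    via-rows : ∀ a b c → c ≡ ½ * ((0ℚ * a + (1ℚ * b + (1ℚ * c + 0ℚ))) + (1ℚ * a + (0ℚ * b + (1ℚ * c + 0ℚ)))
                                  - (1ℚ * a + (1ℚ * b + (0ℚ * c + 0ℚ))))
    via-rows = solve-∀ ℚ-ring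

  K₃-gadget : Gadget 3 3 1 0 1
  K₃-gadget = record
    { graph = complete 3
    ; invariants = record
      { edgeList = Decide.edgeList (complete 3) ((0F , 1F) ∷ (0F , 2F) ∷ (1F , 2F) ∷ [])
      ; maximumMatching = Decide.maximumMatching (complete 3) ((0F , 1F) ∷ []) (λ _ _ → 0F) refl
      ; pivotBasis = nonsingular⇒PivotBasis K₃-nonsingular
      }
    ; attachments = 0F ∷ [] ; attachments-unique = All.[] ∷ [] ; attachments-length = refl
    ; reaches-attachment = λ { 0F → 0F , here refl , here
                             ; 1F → 0F , here refl , step (λ ()) here
                             ; 2F → 0F , here refl , step (λ ()) here }
    }

  oddSide : Fin 4 → Bool
  oddSide 0F = false
  oddSide 1F = true
  oddSide 2F = false
  oddSide 3F = true

  C₄ : Graph 4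
  C₄ = completeBipartite oddSide

  C₄-pivotBasis : PivotBasis (allPositive C₄) 2
  C₄-pivotBasis = record
    { pivot = pivot
    ; basis = basis
    ; basis-pivot = λ { 0F → refl ; 1F → refl }
    ; basis-pivot-≢ = λ { {0F} {0F} 0≢0 → ⊥-elim (0≢0 refl) ; {0F} {1F} _ → refl
                        ; {1F} {0F} _ → refl ; {1F} {1F} 1≢1 → ⊥-elim (1≢1 refl) }
    ; basis-kernel = λ { 0F 0F → refl ; 0F 1F → refl ; 0F 2F → refl ; 0F 3F → refl
                       ; 1F 0F → refl ; 1F 1F → refl ; 1F 2F → refl ; 1F 3F → refl }
    ; kernel-determined = determined
    }
    where
    pivot : Fin 2 → Fin 4
    pivot 0F = 0F
    pivot 1F = 1F
    basis : Fin 2 → Fin 4 → ℚ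
    basis 0F 0F = 1ℚ
    basis 0F 2F = - 1ℚ
    basis 1F 1F = 1ℚ
    basis 1F 3F = - 1ℚ
    basis _ _ = 0ℚ
    difference : ∀ {x y} → x ≡ 0ℚ → y ≡ 0ℚ → x - y ≡ 0ℚ
    difference refl refl = refl
    determined : ∀ v → InKernel (allPositive C₄) v → (∀ l → v (pivot l) ≡ 0ℚ) → ∀ i → v i ≡ 0ℚ
    determined v v∈ker v-pivots≡0 0F = v-pivots≡0 0F
    determined v v∈ker v-pivots≡0 1F = v-pivots≡0 1F
    determined v v∈ker v-pivots≡0 2F =
      ≡.trans (via-row₁ (v 0F) (v 1F) (v 2F) (v 3F)) (difference (v∈ker 1F) (v-pivots≡0 0F))
      where
      via-row₁ : ∀ a b c d → c ≡ (1ℚ * a + (0ℚ * b + (1ℚ * c + (0ℚ * d + 0ℚ)))) - a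
      via-row₁ = solve-∀ ℚ-ring
    determined v v∈ker v-pivots≡0 3F =
      ≡.trans (via-row₀ (v 0F) (v 1F) (v 2F) (v 3F)) (difference (v∈ker 0F) (v-pivots≡0 1F))
      where
      via-row₀ : ∀ a b c d → d ≡ (0ℚ * a + (1ℚ * b + (0ℚ * c + (1ℚ * d + 0ℚ)))) - b
      via-row₀ = solve-∀ ℚ-ring

  C₄-gadget : Gadget 4 4 2 2 1
  C₄-gadget = record
    { graph = C₄
    ; invariants = record
      { edgeList = Decide.edgeList C₄ ((0F , 1F) ∷ (0F , 3F) ∷ (1F , 2F) ∷ (2F , 3F) ∷ [])
      ; maximumMatching = Decide.maximumMatching C₄ ((0F , 1F) ∷ (2F , 3F) ∷ []) evenEndpointClass refl
      ; pivotBasis = C₄-pivotBasis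
      }
    ; attachments = 0F ∷ [] ; attachments-unique = All.[] ∷ [] ; attachments-length = refl
    ; reaches-attachment = λ { 0F → 0F , here refl , here
                             ; 1F → 0F , here refl , step (λ ()) here
                             ; 2F → 0F , here refl , step {j = 1F} (λ ()) (step (λ ()) here)
                             ; 3F → 0F , here refl , step (λ ()) here }
    }
    where
    evenEndpointClass : Fin 4 → Fin 4 → Fin 2
    evenEndpointClass i j = quotient 2 (if oddSide i then j else i)

open LinearAlgebra
open Graphs
open Attachment
open Gadgets
open import Data.Empty using (⊥-elim)
open import Data.Integer using (+_) renaming (_+_ to _+ℤ_; _-_ to _-ℤ_; _*_ to _*ℤ_)
open import Data.Integer.Properties using (pos-+; pos-*)
import Data.Integer.Tactic.RingSolver as ℤ-Solver
open import Data.Nat using (ℕ; zero; suc; _≤_; _+_; _*_; s≤s)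
open import Data.Nat.Properties using (m≤m+n; m≤m*n; ≤-trans; *-suc; +-cancelˡ-≤)
import Data.Nat.Tactic.RingSolver as ℕ-Solver
open import Data.Product using (Σ; ∃-syntax; _×_; _,_)
open import Relation.Binary.PropositionalEquality as ≡ using (_≡_; _≢_; refl; cong; subst; module ≡-Reasoning)

castRooted : ∀ {n e m η n′ e′ m′ η′} → n ≡ n′ → e ≡ e′ → m ≡ m′ → η ≡ η′ →
             Rooted n e m η → Rooted n′ e′ m′ η′
castRooted refl refl refl refl R = R

attachMany : ∀ {n e m η n′ e′ m′ η′ t} → Gadget n′ e′ m′ η′ t → (r : ℕ) → Rooted n e m η →
             Rooted (r * n′ + n) (r * (e′ + t) + e) (r * m′ + m) (r * η′ + η)
attachMany D zero R = R
attachMany {n} {e} {m} {η} {n′} {e′} {m′} {η′} {t} D (suc r) R =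
  castRooted (reassoc r n n′) (reassoc r e (e′ + t)) (reassoc r m m′) (reassoc r η η′)
             (attach (attachMany D r R) D)
  where
  reassoc : ∀ r x y → r * y + x + y ≡ (y + r * y) + x
  reassoc = ℕ-Solver.solve-∀

-- The indices are in the unnormalised shape produced by attachMany.
construction : ∀ N a b z → Rooted (N * 1 + (a * 2 + (b * 3 + (z * 4 + 2))))
                                  (N * 1 + (a * 3 + (b * 4 + (z * 5 + 1))))
                                  (N * 0 + (a * 1 + (b * 1 + (z * 2 + 1))))
                                  (N * 1 + (a * 0 + (b * 0 + (z * 2 + 0))))
construction N a b z =
  attachMany K₁-gadget N (attachMany K₂-gadget a (attachMany K₃-gadget b (attachMany C₄-gadget z K₂-rooted)))

Decomposition : ℕ → ℕ → Set
Decomposition c s = ∃[ a ] ∃[ b ] ∃[ z ] a + b + z ≡ c × 2 * a + 3 * b ≡ s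

Decomposition-suc : ∀ {c s} → Decomposition c s → Decomposition (suc c) (3 + s)
Decomposition-suc (a , b , z , refl , refl) = a , suc b , z , one-more a b z , three-more a b
  where
  one-more : ∀ a b z → a + suc b + z ≡ suc (a + b + z)
  one-more = ℕ-Solver.solve-∀
  three-more : ∀ a b → 2 * a + 3 * suc b ≡ 3 + (2 * a + 3 * b)
  three-more = ℕ-Solver.solve-∀

decompose : ∀ c s → s ≤ 3 * c → s ≢ 1 → Decomposition c s
decompose c 0 _ _ = 0 , 0 , c , refl , refl
decompose c 1 _ s≢1 = ⊥-elim (s≢1 refl)
decompose zero (suc (suc s)) () _
decompose (suc c) 2 _ _ = 1 , 0 , c , refl , refl
decompose (suc c) 3 _ _ = 0 , 1 , c , refl , refl
decompose (suc zero) 4 (s≤s (s≤s (s≤s ()))) _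
decompose (suc (suc c)) 4 _ _ = 2 , 0 , c , refl , refl
decompose (suc c) (suc (suc (suc (suc (suc s))))) 5+s≤3+3c _ =
  Decomposition-suc (decompose c (2 + s) (+-cancelˡ-≤ 3 _ _ (subst (5 + s ≤_) (*-suc 3 c) 5+s≤3+3c)) (λ ()))

nullity-formula : ∀ {n m η} c s → n + 2 * c ≡ η + 2 * m + s →
                  (+ η) ≡ (+ n) -ℤ (+ 2) *ℤ (+ m) +ℤ (+ 2) *ℤ (+ c) -ℤ (+ s)
nullity-formula {n} {m} {η} c s balance = begin
  + η                                                        ≡⟨ cancel (+ η) (+ m) (+ s) ⟩
  (+ η) +ℤ (+ 2) *ℤ (+ m) +ℤ (+ s) -ℤ (+ 2) *ℤ (+ m) -ℤ (+ s)  ≡⟨ cong (λ x → x -ℤ (+ 2) *ℤ (+ m) -ℤ (+ s)) balanceℤ ⟨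
  (+ n) +ℤ (+ 2) *ℤ (+ c) -ℤ (+ 2) *ℤ (+ m) -ℤ (+ s)          ≡⟨ rearrange (+ n) (+ m) (+ c) (+ s) ⟩
  (+ n) -ℤ (+ 2) *ℤ (+ m) +ℤ (+ 2) *ℤ (+ c) -ℤ (+ s)          ∎
  where
  open ≡-Reasoning
  cancel : ∀ x y z → x ≡ x +ℤ (+ 2) *ℤ y +ℤ z -ℤ (+ 2) *ℤ y -ℤ z
  cancel = ℤ-Solver.solve-∀
  rearrange : ∀ w x y z → w +ℤ (+ 2) *ℤ y -ℤ (+ 2) *ℤ x -ℤ z ≡ w -ℤ (+ 2) *ℤ x +ℤ (+ 2) *ℤ y -ℤ z
  rearrange = ℤ-Solver.solve-∀
  balanceℤ : (+ n) +ℤ (+ 2) *ℤ (+ c) ≡ (+ η) +ℤ (+ 2) *ℤ (+ m) +ℤ (+ s)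
  balanceℤ = begin
    (+ n) +ℤ (+ 2) *ℤ (+ c)             ≡⟨ cong ((+ n) +ℤ_) (pos-* 2 c) ⟨
    (+ n) +ℤ + (2 * c)                  ≡⟨ pos-+ n (2 * c) ⟨
    + (n + 2 * c)                       ≡⟨ cong +_ balance ⟩
    + (η + 2 * m + s)                   ≡⟨ pos-+ (η + 2 * m) s ⟩
    + (η + 2 * m) +ℤ (+ s)              ≡⟨ cong (_+ℤ (+ s)) (pos-+ η (2 * m)) ⟩
    (+ η) +ℤ + (2 * m) +ℤ (+ s)         ≡⟨ cong (λ x → (+ η) +ℤ x +ℤ (+ s)) (pos-* 2 m) ⟩
    (+ η) +ℤ (+ 2) *ℤ (+ m) +ℤ (+ s)    ∎

realise : ∀ {n e m η} c s N → Rooted n e m η → N ≤ n → e + 1 ≡ n + c → n + 2 * c ≡ η + 2 * m + s →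
  Σ SignedGraph λ Γ → N ≤ order Γ × Connected Γ ×
    Σ ℕ λ e → HasEdgeCount Γ e × e + 1 ≡ order Γ + c ×
    Σ ℕ λ m → HasMatchingNumber Γ m ×
    Σ ℕ λ η → HasNullity Γ η ×
      (+ η) ≡ (+ order Γ) -ℤ (+ 2) *ℤ (+ m) +ℤ (+ 2) *ℤ (+ c) -ℤ (+ s)
realise {n} {m = m} c s N R N≤n cyclomatic balance =
  allPositive graph , N≤n , hub⇒Connected hub reaches-hub ,
  _ , EdgeList.hasEdgeCount edgeList , cyclomatic ,
  _ , MaximumMatching.hasMatchingNumber maximumMatching ,
  _ , PivotBasis.nullity pivotBasis , nullity-formula {n} {m} c s balance
  where
  open Rooted R
  open Invariants invariants

theorem5p1 : (c s : ℕ) → s ≤ 3 * c → s ≢ 1 →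
    (N : ℕ) → Σ SignedGraph λ Γ → N ≤ order Γ × Connected Γ ×
      Σ ℕ λ e → HasEdgeCount Γ e × e + 1 ≡ order Γ + c ×
      Σ ℕ λ m → HasMatchingNumber Γ m ×
      Σ ℕ λ η → HasNullity Γ η ×
        (+ η) ≡ (+ order Γ) -ℤ (+ 2) *ℤ (+ m) +ℤ (+ 2) *ℤ (+ c) -ℤ (+ s)
theorem5p1 c s s≤3c s≢1 N with decompose c s s≤3c s≢1
... | a , b , z , refl , refl =
  realise (a + b + z) (2 * a + 3 * b) N (construction N a b z) (≤-trans (m≤m*n N 1) (m≤m+n (N * 1) _))
          (cyclomatic N a b z) (balance N a b z)
  where
  cyclomatic : ∀ N a b z → N * 1 + (a * 3 + (b * 4 + (z * 5 + 1))) + 1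
                         ≡ N * 1 + (a * 2 + (b * 3 + (z * 4 + 2))) + (a + b + z)
  cyclomatic = ℕ-Solver.solve-∀
  balance : ∀ N a b z → N * 1 + (a * 2 + (b * 3 + (z * 4 + 2))) + 2 * (a + b + z)
                      ≡ N * 1 + (a * 0 + (b * 0 + (z * 2 + 0))) + 2 * (N * 0 + (a * 1 + (b * 1 + (z * 2 + 1))))
                        + (2 * a + 3 * b)
  balance = ℕ-Solver.solve-∀
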